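{- Let $m$ and $n$ be positive integers with $n \geq 4$ even, let $0 \leq \ell \leq n-1$ be an integer of the same parity as $m$, and let $$G = \langle t,x,y \mid t^2,\ x^{n/2},\ y^m = x^{(\ell + m)/2},\ txt = x^{ -1},\ tyt = y^{ -1},\ xy = yx\rangle.$$ Let $\mathrm{Aut}(G;\{t,tx,ty\})$ denote the group of automorphisms of $G$ mapping the set $\{t,tx,ty\}$ onto itself. Then $\mathrm{Aut}(G;\{t,tx,ty\}) \cong S_3$ if and only if $n = 2\ell$ and either $\ell = m$ or $\ell = 3m$. -}

module Defs where

open import Level using (Level; _⊔_) renaming (suc to lsuc)
open import Data.Nat using (ℕ; zero; suc; _/_)
open import Data.Product using (Σ; ∃; _×_; _,_)
open import Data.Sum using (_⊎_)
open import Algebra.Bundles using (Group)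
open import Algebra.Morphism.Structures using (module GroupMorphisms)
open import Data.Fin.Permutation using (Permutation′; _∘ₚ_) renaming (_≈_ to _≈ₚ_)

module _ {c ℓ} (G : Group c ℓ) where
  open Group G

  pow : Carrier → ℕ → Carrier
  pow g zero    = ε
  pow g (suc k) = g ∙ pow g k

module _ {c ℓ} (H : Group c ℓ) where
  open Group H

  Rels : (n m l : ℕ) → (t x y : Carrier) → Set ℓ
  Rels n m l t x y =
      (t ∙ t ≈ ε)
    × (pow H x (n / 2) ≈ ε)
    × (pow H y m ≈ pow H x ((l + m) / 2))
    × ((t ∙ x) ∙ t ≈ x ⁻¹)
    × ((t ∙ y) ∙ t ≈ y ⁻¹)
    × (x ∙ y ≈ y ∙ x)
    where open Data.Nat using (_+_)

record IsPresentation {c ℓ} (G : Group c ℓ) (n m l : ℕ)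
                      (t x y : Group.Carrier G) : Set (lsuc (c ⊔ ℓ)) where
  open Group G using (Carrier)
  field
    relations : Rels G n m l t x y
    extend : (H : Group c ℓ) (t′ x′ y′ : Group.Carrier H) → Rels H n m l t′ x′ y′ →
      Σ (Carrier → Group.Carrier H) λ f →
        GroupMorphisms.IsGroupHomomorphism (Group.rawGroup G) (Group.rawGroup H) f
        × Group._≈_ H (f t) t′ × Group._≈_ H (f x) x′ × Group._≈_ H (f y) y′
    unique : (H : Group c ℓ) (f g : Carrier → Group.Carrier H) →
      GroupMorphisms.IsGroupHomomorphism (Group.rawGroup G) (Group.rawGroup H) f →
      GroupMorphisms.IsGroupHomomorphism (Group.rawGroup G) (Group.rawGroup H) g →
      Group._≈_ H (f t) (g t) → Group._≈_ H (f x) (g x) → Group._≈_ H (f y) (g y) →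
      ∀ z → Group._≈_ H (f z) (g z)

module _ {c ℓ} (G : Group c ℓ) (t x y : Group.Carrier G) where
  open Group G

  InS : Carrier → Set ℓ
  InS g = (g ≈ t) ⊎ (g ≈ t ∙ x) ⊎ (g ≈ t ∙ y)

  record AutS : Set (c ⊔ ℓ) where
    field
      fun   : Carrier → Carrier
      isAut : GroupMorphisms.IsGroupIsomorphism rawGroup rawGroup fun
      into  : ∀ s → InS s → InS (fun s)
      onto  : ∀ s → InS s → ∃ λ s′ → InS s′ × (fun s′ ≈ s)

  open AutS

  _≈A_ : AutS → AutS → Set (c ⊔ ℓ)
  α ≈A β = ∀ z → fun α z ≈ fun β z

  IsComp : AutS → AutS → AutS → Set (c ⊔ ℓ)
  IsComp γ α β = ∀ z → fun γ z ≈ fun α (fun β z)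

  -- Note: π ∘ₚ ρ means "first π, then ρ".
  AutS≅S₃ : Set (c ⊔ ℓ)
  AutS≅S₃ =
    Σ (AutS → Permutation′ 3) λ φ →
    Σ (Permutation′ 3 → AutS) λ ψ →
        (∀ α β → α ≈A β → φ α ≈ₚ φ β)
      × (∀ π → φ (ψ π) ≈ₚ π)
      × (∀ α → ψ (φ α) ≈A α)
      × (∀ α β γ → IsComp γ α β → φ γ ≈ₚ (φ β ∘ₚ φ α))

-- Let L ⊆ ℤ² be the lattice spanned by (h , 0) and (- k , m), where h = n/2 and
-- k = (l+m)/2.  The universal property maps G onto the affine maps w ↦ v ± w of
-- ℤ²/L, sending t to w ↦ - w and x, y to the translations by (1 , 0), (0 , 1);
-- this model is used to separate elements of G.
--
-- An automorphism is determined by its values on S = {t, tx, ty}, which generate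
-- G, so Aut(G; S) acts faithfully on S.  If ty ∈ {t, tx}, at most two
-- automorphisms remain.  Otherwise Aut(G; S) ≅ S₃ exactly when the transpositions
-- (tx ty) and (t tx) are realised, i.e. when (t, y, x) and (tx, x⁻¹, x⁻¹y) satisfy
-- the defining relations.  In the model this says that (0 , h), (m , - k) and
-- (k - m , m) lie in L.  These give l = h and, with h = r m, - k = q m and
-- m = p h - q k, the identity r (4p + r + 2) = 3; hence r = 1 or r = 3.

module Submission where

open import Level using (Level; Lift; lift; lower)
open import Data.Bool using (Bool; true; false; _xor_)
open import Data.Nat as ℕ using (ℕ; zero; suc)
open import Data.Product using (Σ; ∃; ∃₂; _×_; _,_; proj₁; proj₂)
open import Data.Sum using (_⊎_; inj₁; inj₂)
open import Data.Empty using (⊥-elim)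
open import Data.Integer using (ℤ)
open import Relation.Binary.PropositionalEquality as ≡ using (_≡_; _≢_)
open import Algebra.Bundles using (Group; AbelianGroup)
open import Algebra.Morphism.Structures using (module GroupMorphisms)
import Algebra.Properties.Group as GroupProperties
import Relation.Binary.Reasoning.Setoid as SetoidReasoning
open import Defs

module Powers {c ℓ} (G : Group c ℓ) where
  open Group G
  open GroupProperties G
  open SetoidReasoning setoid

  infixr 8 _^_
  _^_ : Carrier → ℕ → Carrier
  g ^ j = pow G g j

  ^-congˡ : ∀ {g h} j → g ≈ h → g ^ j ≈ h ^ j
  ^-congˡ zero    _   = refl
  ^-congˡ (suc j) g≈h = ∙-cong g≈h (^-congˡ j g≈h)

  ^-congʳ : ∀ {g i j} → i ≡ j → g ^ i ≈ g ^ j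
  ^-congʳ ≡.refl = refl

  ^-+ : ∀ g i j → g ^ (i ℕ.+ j) ≈ g ^ i ∙ g ^ j
  ^-+ g zero    j = sym (identityˡ (g ^ j))
  ^-+ g (suc i) j = trans (∙-congˡ (^-+ g i j)) (sym (assoc g (g ^ i) (g ^ j)))

  ^-* : ∀ g i j → g ^ (i ℕ.* j) ≈ (g ^ j) ^ i
  ^-* g zero    j = refl
  ^-* g (suc i) j = trans (^-+ g j (i ℕ.* j)) (∙-congˡ (^-* g i j))

  ε^j≈ε : ∀ j → ε ^ j ≈ ε
  ε^j≈ε zero    = refl
  ε^j≈ε (suc j) = trans (identityˡ _) (ε^j≈ε j)

  ^-periodic : ∀ {g} i j → g ^ i ≈ ε → g ^ (i ℕ.+ j) ≈ g ^ j
  ^-periodic {g} i j gⁱ≈ε = trans (^-+ g i j) (trans (∙-congʳ gⁱ≈ε) (identityˡ (g ^ j)))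

  ^-multiple≈ε : ∀ {g} i j → g ^ i ≈ ε → g ^ (j ℕ.* i) ≈ ε
  ^-multiple≈ε {g} i j gⁱ≈ε = trans (^-* g j i) (trans (^-congˡ j gⁱ≈ε) (ε^j≈ε j))

  ∙-comm-^ : ∀ {g h} j → g ∙ h ≈ h ∙ g → g ∙ h ^ j ≈ h ^ j ∙ g
  ∙-comm-^ {g} {h} zero    _   = trans (identityʳ g) (sym (identityˡ g))
  ∙-comm-^ {g} {h} (suc j) gh≈hg = begin
    g ∙ (h ∙ h ^ j)  ≈⟨ assoc g h (h ^ j) ⟨
    (g ∙ h) ∙ h ^ j  ≈⟨ ∙-congʳ gh≈hg ⟩
    (h ∙ g) ∙ h ^ j  ≈⟨ assoc h g (h ^ j) ⟩
    h ∙ (g ∙ h ^ j)  ≈⟨ ∙-congˡ (∙-comm-^ j gh≈hg) ⟩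
    h ∙ (h ^ j ∙ g)  ≈⟨ assoc h (h ^ j) g ⟨
    (h ∙ h ^ j) ∙ g  ∎

  ^-distrib-∙ : ∀ {g h} j → g ∙ h ≈ h ∙ g → (g ∙ h) ^ j ≈ g ^ j ∙ h ^ j
  ^-distrib-∙ zero    _ = sym (identityˡ ε)
  ^-distrib-∙ {g} {h} (suc j) gh≈hg = begin
    (g ∙ h) ∙ (g ∙ h) ^ j        ≈⟨ ∙-congˡ (^-distrib-∙ j gh≈hg) ⟩
    (g ∙ h) ∙ (g ^ j ∙ h ^ j)    ≈⟨ assoc g h _ ⟩
    g ∙ (h ∙ (g ^ j ∙ h ^ j))    ≈⟨ ∙-congˡ (assoc h (g ^ j) (h ^ j)) ⟨
    g ∙ ((h ∙ g ^ j) ∙ h ^ j)    ≈⟨ ∙-congˡ (∙-congʳ (∙-comm-^ j (sym gh≈hg))) ⟩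
    g ∙ ((g ^ j ∙ h) ∙ h ^ j)    ≈⟨ ∙-congˡ (assoc (g ^ j) h (h ^ j)) ⟩
    g ∙ (g ^ j ∙ (h ∙ h ^ j))    ≈⟨ assoc g (g ^ j) _ ⟨
    (g ∙ g ^ j) ∙ (h ∙ h ^ j)    ∎

  ⁻¹-^ : ∀ g j → (g ⁻¹) ^ j ≈ (g ^ j) ⁻¹
  ⁻¹-^ g j = inverseʳ-unique (g ^ j) ((g ⁻¹) ^ j) (begin
    g ^ j ∙ (g ⁻¹) ^ j  ≈⟨ ^-distrib-∙ j (trans (inverseʳ g) (sym (inverseˡ g))) ⟨
    (g ∙ g ⁻¹) ^ j      ≈⟨ ^-congˡ j (inverseʳ g) ⟩
    ε ^ j               ≈⟨ ε^j≈ε j ⟩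
    ε                   ∎)

  ⁻¹-comm : ∀ {g h} → g ∙ h ≈ h ∙ g → g ⁻¹ ∙ h ≈ h ∙ g ⁻¹
  ⁻¹-comm {g} {h} gh≈hg = ∙-cancelˡ g _ _ (begin
    g ∙ (g ⁻¹ ∙ h)    ≈⟨ assoc g (g ⁻¹) h ⟨
    (g ∙ g ⁻¹) ∙ h    ≈⟨ ∙-congʳ (inverseʳ g) ⟩
    ε ∙ h             ≈⟨ identityˡ h ⟩
    h                 ≈⟨ identityʳ h ⟨
    h ∙ ε             ≈⟨ ∙-congˡ (inverseʳ g) ⟨
    h ∙ (g ∙ g ⁻¹)    ≈⟨ assoc h g (g ⁻¹) ⟨
    (h ∙ g) ∙ g ⁻¹    ≈⟨ ∙-congʳ gh≈hg ⟨
    (g ∙ h) ∙ g ⁻¹    ≈⟨ assoc g h (g ⁻¹) ⟩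
    g ∙ (h ∙ g ⁻¹)    ∎)

module _ {c ℓ} {H : Group c ℓ} where
  open Group H
  open Powers H

  Rels-cong : ∀ {n m l t x y t′ x′ y′} → t ≈ t′ → x ≈ x′ → y ≈ y′ →
              Rels H n m l t x y → Rels H n m l t′ x′ y′
  Rels-cong {n} {m} {l} t≈ x≈ y≈ (tt , xʰ , yᵐ , txt , tyt , xy) =
      trans (sym (∙-cong t≈ t≈)) tt
    , trans (sym (^-congˡ (n ℕ./ 2) x≈)) xʰ
    , trans (sym (^-congˡ m y≈)) (trans yᵐ (^-congˡ ((l ℕ.+ m) ℕ./ 2) x≈))
    , trans (sym (∙-cong (∙-cong t≈ x≈) t≈)) (trans txt (⁻¹-cong x≈))
    , trans (sym (∙-cong (∙-cong t≈ y≈) t≈)) (trans tyt (⁻¹-cong y≈))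
    , trans (sym (∙-cong x≈ y≈)) (trans xy (∙-cong y≈ x≈))

module _ {c₁ ℓ₁ c₂ ℓ₂} {G : Group c₁ ℓ₁} {H : Group c₂ ℓ₂}
         {F : Group.Carrier G → Group.Carrier H}
         (F-hom : GroupMorphisms.IsGroupHomomorphism (Group.rawGroup G) (Group.rawGroup H) F)
         where
  private
    module G = Group G
  open Group H
  open GroupMorphisms.IsGroupHomomorphism F-hom

  ⟦⟧-translate : ∀ a g → F g ≈ F a ⁻¹ ∙ F (a G.∙ g)
  ⟦⟧-translate a g =
    trans (⟦⟧-cong (G.sym (\\-leftDividesʳ a g))) (trans (homo (a G.⁻¹) (a G.∙ g)) (∙-congʳ (⁻¹-homo a)))
    where open GroupProperties G using (\\-leftDividesʳ)

  ^-homo : ∀ g j → F (pow G g j) ≈ pow H (F g) j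
  ^-homo g zero    = ε-homo
  ^-homo g (suc j) = trans (homo g (pow G g j)) (∙-congˡ (^-homo g j))

  Rels-homo : ∀ {n m l t x y} → Rels G n m l t x y → Rels H n m l (F t) (F x) (F y)
  Rels-homo {n} {m} {l} {t} {x} {y} (tt , xʰ , yᵐ , txt , tyt , xy) =
      trans (sym (homo t t)) (trans (⟦⟧-cong tt) ε-homo)
    , trans (sym (^-homo x (n ℕ./ 2))) (trans (⟦⟧-cong xʰ) ε-homo)
    , trans (sym (^-homo y m)) (trans (⟦⟧-cong yᵐ) (^-homo x ((l ℕ.+ m) ℕ./ 2)))
    , conjugation txt
    , conjugation tyt
    , trans (sym (homo x y)) (trans (⟦⟧-cong xy) (homo y x))
    where
    conjugation : ∀ {z} → (t G.∙ z) G.∙ t G.≈ z G.⁻¹ → (F t ∙ F z) ∙ F t ≈ F z ⁻¹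
    conjugation {z} tzt =
      trans (sym (trans (homo (t G.∙ z) t) (∙-congʳ (homo t z))))
            (trans (⟦⟧-cong tzt) (⁻¹-homo z))

module Dihedral {a ℓ} (A : AbelianGroup a ℓ) where
  open AbelianGroup A
    using ()
    renaming ( Carrier to V; _≈_ to _≈ᵥ_; _∙_ to _+_; ε to 0#; _⁻¹ to -_
             ; refl to reflᵥ; sym to symᵥ; trans to transᵥ; ∙-cong to +-cong
             ; assoc to +-assoc; identityˡ to +-identityˡ; identityʳ to +-identityʳ
             ; inverseˡ to -‿inverseˡ; inverseʳ to -‿inverseʳ; ⁻¹-cong to -‿cong
             ; rawMonoid to rawMonoidᵥ; group to groupᵥ)
  open GroupProperties groupᵥ using (ε⁻¹≈ε; ⁻¹-involutive)
  open import Algebra.Properties.AbelianGroup A using (⁻¹-∙-comm)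
  open import Algebra.Definitions.RawMonoid rawMonoidᵥ public using () renaming (_×_ to _·_)

  reflect : Bool → V → V
  reflect false v = v
  reflect true  v = - v

  reflect-cong : ∀ s {u v} → u ≈ᵥ v → reflect s u ≈ᵥ reflect s v
  reflect-cong false u≈v = u≈v
  reflect-cong true  u≈v = -‿cong u≈v

  reflect-+ : ∀ s u v → reflect s (u + v) ≈ᵥ reflect s u + reflect s v
  reflect-+ false u v = reflᵥ
  reflect-+ true  u v = symᵥ (⁻¹-∙-comm u v)

  reflect-xor : ∀ s s′ v → reflect (s xor s′) v ≈ᵥ reflect s (reflect s′ v)
  reflect-xor false s′    v = reflᵥ
  reflect-xor true  false v = reflᵥ
  reflect-xor true  true  v = symᵥ (⁻¹-involutive v)

  reflect-0# : ∀ s → reflect s 0# ≈ᵥ 0#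
  reflect-0# false = reflᵥ
  reflect-0# true  = ε⁻¹≈ε

  reflect-involutive : ∀ s v → reflect s (reflect s v) ≈ᵥ v
  reflect-involutive false v = reflᵥ
  reflect-involutive true  v = ⁻¹-involutive v

  -- (s , v) is the affine map w ↦ v + reflect s w, and the product is composition
  Affine : Set a
  Affine = Bool × V

  _≈_ : Affine → Affine → Set ℓ
  (s , u) ≈ (s′ , v) = s ≡ s′ × u ≈ᵥ v

  _∙_ : Affine → Affine → Affine
  (s , u) ∙ (s′ , v) = s xor s′ , u + reflect s v

  ε : Affine
  ε = false , 0#

  _⁻¹ : Affine → Affine
  (s , u) ⁻¹ = s , - reflect s u

  private
    open import Data.Bool.Properties using (xor-assoc; xor-identityʳ; xor-same)
    open SetoidReasoning (AbelianGroup.setoid A)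

    ∙-assoc : ∀ g h k → ((g ∙ h) ∙ k) ≈ (g ∙ (h ∙ k))
    ∙-assoc (s , u) (s′ , v) (s″ , w) = xor-assoc s s′ s″ , (begin
      (u + reflect s v) + reflect (s xor s′) w        ≈⟨ +-cong reflᵥ (reflect-xor s s′ w) ⟩
      (u + reflect s v) + reflect s (reflect s′ w)    ≈⟨ +-assoc u _ _ ⟩
      u + (reflect s v + reflect s (reflect s′ w))    ≈⟨ +-cong reflᵥ (reflect-+ s v _) ⟨
      u + reflect s (v + reflect s′ w)                ∎)

    ∙-identityʳ : ∀ g → (g ∙ ε) ≈ g
    ∙-identityʳ (s , u) = xor-identityʳ s , transᵥ (+-cong reflᵥ (reflect-0# s)) (+-identityʳ u)

    ∙-inverseʳ : ∀ g → (g ∙ (g ⁻¹)) ≈ ε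
    ∙-inverseʳ (s , u) = xor-same s , (begin
      u + reflect s (- reflect s u)    ≈⟨ +-cong reflᵥ (reflect-- s (reflect s u)) ⟩
      u + - reflect s (reflect s u)    ≈⟨ +-cong reflᵥ (-‿cong (reflect-involutive s u)) ⟩
      u + - u                          ≈⟨ -‿inverseʳ u ⟩
      0#                               ∎)
      where
      reflect-- : ∀ s v → reflect s (- v) ≈ᵥ - reflect s v
      reflect-- false v = reflᵥ
      reflect-- true  v = reflᵥ

  dihedral : Group a ℓ
  dihedral = record
    { Carrier = Affine ; _≈_ = _≈_ ; _∙_ = _∙_ ; ε = ε ; _⁻¹ = _⁻¹
    ; isGroup = record
      { isMonoid = record
        { isSemigroup = record
          { isMagma = record
            { isEquivalence = record
              { refl  = ≡.refl , reflᵥ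
              ; sym   = λ (s≡ , u≈) → ≡.sym s≡ , symᵥ u≈
              ; trans = λ (s≡ , u≈) (s≡′ , u≈′) → ≡.trans s≡ s≡′ , transᵥ u≈ u≈′ }
            ; ∙-cong = λ { {s , _} (≡.refl , u≈) (≡.refl , v≈) → ≡.refl , +-cong u≈ (reflect-cong s v≈) } }
          ; assoc = ∙-assoc }
        ; identity = (λ (s , u) → ≡.refl , +-identityˡ u) , ∙-identityʳ }
      ; inverse = (λ (s , u) → xor-same s , -‿inverseˡ (reflect s u)) , ∙-inverseʳ
      ; ⁻¹-cong = λ { {s , _} (≡.refl , u≈) → ≡.refl , -‿cong (reflect-cong s u≈) } } }

  rotation-^ : ∀ v j → pow dihedral (false , v) j ≈ (false , j · v)
  rotation-^ v zero    = ≡.refl , reflᵥ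
  rotation-^ v (suc j) = let s≡ , u≈ = rotation-^ v j in s≡ , +-cong reflᵥ u≈

module LatticeQuotient (h k m : ℤ) where
  open import Data.Integer using (+_; -_; _+_; _*_; _-_; 0ℤ; 1ℤ)
  open import Data.Integer.Tactic.RingSolver using (solve-∀)

  ℤ² : Set
  ℤ² = ℤ × ℤ

  InLattice : ℤ² → Set
  InLattice (a , b) = ∃₂ λ p q → (p * h - q * k ≡ a) × (q * m ≡ b)

  infixl 6 _⊕_
  infix  8 ⊖_
  infixr 7 _⊛_
  infix  4 _∼_

  _⊕_ : ℤ² → ℤ² → ℤ²
  (a , b) ⊕ (a′ , b′) = a + a′ , b + b′

  ⊖_ : ℤ² → ℤ²
  ⊖ (a , b) = - a , - b

  _⊛_ : ℤ → ℤ² → ℤ²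
  j ⊛ (a , b) = j * a , j * b

  record _∼_ (u v : ℤ²) : Set where
    constructor congruent
    field difference : InLattice (u ⊕ ⊖ v)
  open _∼_ public

  private
    neg-span : ∀ p q h k → (- p) * h - (- q) * k ≡ - (p * h - q * k)
    neg-span = solve-∀

    neg-*ˡ : ∀ q m → (- q) * m ≡ - (q * m)
    neg-*ˡ = solve-∀

    +-span : ∀ p q p′ q′ h k → (p + p′) * h - (q + q′) * k ≡ (p * h - q * k) + (p′ * h - q′ * k)
    +-span = solve-∀

    +-*ʳ : ∀ q q′ m → (q + q′) * m ≡ q * m + q′ * m
    +-*ʳ = solve-∀

    self-minus : ∀ a → a - a ≡ 0ℤ
    self-minus = solve-∀

    minus-antisym : ∀ a b → - (a - b) ≡ b - a
    minus-antisym = solve-∀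

    minus-chain : ∀ a b c → (a - b) + (b - c) ≡ a - c
    minus-chain = solve-∀

    minus-+ : ∀ a b a′ b′ → (a + b) - (a′ + b′) ≡ (a - a′) + (b - b′)
    minus-+ = solve-∀

    minus-neg : ∀ a a′ → - a - - a′ ≡ - (a - a′)
    minus-neg = solve-∀

  InLattice-resp : ∀ {u v} → u ≡ v → InLattice u → InLattice v
  InLattice-resp = ≡.subst InLattice

  lattice-0 : InLattice (0ℤ , 0ℤ)
  lattice-0 = 0ℤ , 0ℤ , ≡.refl , ≡.refl

  lattice-⊖ : ∀ {u} → InLattice u → InLattice (⊖ u)
  lattice-⊖ (p , q , e₁ , e₂) =
    - p , - q , ≡.trans (neg-span p q h k) (≡.cong -_ e₁) , ≡.trans (neg-*ˡ q m) (≡.cong -_ e₂)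

  lattice-⊕ : ∀ {u v} → InLattice u → InLattice v → InLattice (u ⊕ v)
  lattice-⊕ (p , q , e₁ , e₂) (p′ , q′ , e₁′ , e₂′) =
    p + p′ , q + q′ , ≡.trans (+-span p q p′ q′ h k) (≡.cong₂ _+_ e₁ e₁′)
                    , ≡.trans (+-*ʳ q q′ m) (≡.cong₂ _+_ e₂ e₂′)

  ≡⇒∼ : ∀ {u v} → u ≡ v → u ∼ v
  ≡⇒∼ {a , b} ≡.refl =
    congruent (InLattice-resp (≡.sym (≡.cong₂ _,_ (self-minus a) (self-minus b))) lattice-0)

  ∼-sym : ∀ {u v} → u ∼ v → v ∼ u
  ∼-sym {a , b} {a′ , b′} (congruent d) =
    congruent (InLattice-resp (≡.cong₂ _,_ (minus-antisym a a′) (minus-antisym b b′)) (lattice-⊖ d))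

  ∼-trans : ∀ {u v w} → u ∼ v → v ∼ w → u ∼ w
  ∼-trans {a , b} {a′ , b′} {a″ , b″} (congruent d) (congruent d′) =
    congruent (InLattice-resp (≡.cong₂ _,_ (minus-chain a a′ a″) (minus-chain b b′ b″)) (lattice-⊕ d d′))

  ⊕-cong : ∀ {u u′ v v′} → u ∼ u′ → v ∼ v′ → u ⊕ v ∼ u′ ⊕ v′
  ⊕-cong {a , b} {a′ , b′} {c , d} {c′ , d′} (congruent e) (congruent e′) =
    congruent (InLattice-resp (≡.sym (≡.cong₂ _,_ (minus-+ a c a′ c′) (minus-+ b d b′ d′))) (lattice-⊕ e e′))

  ⊖-cong : ∀ {u u′} → u ∼ u′ → ⊖ u ∼ ⊖ u′
  ⊖-cong {a , b} {a′ , b′} (congruent d) =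
    congruent (InLattice-resp (≡.sym (≡.cong₂ _,_ (minus-neg a a′) (minus-neg b b′))) (lattice-⊖ d))

  -- at arbitrary levels, because the universal property of G only reaches
  -- groups at the levels of G
  module _ (c ℓ : Level) where
    private
      open import Data.Integer.Properties
        using (+-assoc; +-comm; +-identityˡ; +-identityʳ; +-inverseˡ; +-inverseʳ)

      ≡⇒≈ : ∀ {u v} → u ≡ v → Lift ℓ (u ∼ v)
      ≡⇒≈ u≡v = lift (≡⇒∼ u≡v)

    ℤ²/lattice : AbelianGroup c ℓ
    ℤ²/lattice = record
      { Carrier = Lift c ℤ²
      ; _≈_ = λ u v → Lift ℓ (lower u ∼ lower v)
      ; _∙_ = λ u v → lift (lower u ⊕ lower v)
      ; ε = lift (0ℤ , 0ℤ)
      ; _⁻¹ = λ u → lift (⊖ lower u)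
      ; isAbelianGroup = record
        { isGroup = record
          { isMonoid = record
            { isSemigroup = record
              { isMagma = record
                { isEquivalence = record
                  { refl = ≡⇒≈ ≡.refl
                  ; sym = λ u∼v → lift (∼-sym (lower u∼v))
                  ; trans = λ u∼v v∼w → lift (∼-trans (lower u∼v) (lower v∼w)) }
                ; ∙-cong = λ u∼u′ v∼v′ → lift (⊕-cong (lower u∼u′) (lower v∼v′)) }
              ; assoc = λ (lift (a , b)) (lift (a′ , b′)) (lift (a″ , b″)) →
                  ≡⇒≈ (≡.cong₂ _,_ (+-assoc a a′ a″) (+-assoc b b′ b″)) }
            ; identity = (λ (lift (a , b)) → ≡⇒≈ (≡.cong₂ _,_ (+-identityˡ a) (+-identityˡ b)))
                       , (λ (lift (a , b)) → ≡⇒≈ (≡.cong₂ _,_ (+-identityʳ a) (+-identityʳ b))) }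
          ; inverse = (λ (lift (a , b)) → ≡⇒≈ (≡.cong₂ _,_ (+-inverseˡ a) (+-inverseˡ b)))
                    , (λ (lift (a , b)) → ≡⇒≈ (≡.cong₂ _,_ (+-inverseʳ a) (+-inverseʳ b)))
          ; ⁻¹-cong = λ u∼u′ → lift (⊖-cong (lower u∼u′)) }
        ; comm = λ (lift (a , b)) (lift (a′ , b′)) → ≡⇒≈ (≡.cong₂ _,_ (+-comm a a′) (+-comm b b′)) } }

module LatticeArithmetic (h k m l : ℕ) (2≤h : 2 ℕ.≤ h) (1≤m : 1 ℕ.≤ m)
                         (l<2h : l ℕ.< 2 ℕ.* h) (l+m≡2k : l ℕ.+ m ≡ 2 ℕ.* k) where
  open import Data.Integer using (+_; -_; _+_; _*_; _-_; 0ℤ; 1ℤ; -1ℤ; ∣_∣; -[1+_]; +[1+_])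
  import Data.Integer.Properties as ℤ
  import Data.Nat.Properties as ℕ
  open import Data.Integer.Tactic.RingSolver using (solve-∀)
  open import Data.Sum using ([_,_]′; map)
  open import Function using (_∘_)
  open import Relation.Nullary using (¬_)
  open ≡.≡-Reasoning
  open LatticeQuotient (+ h) (+ k) (+ m) using (InLattice)

  private
    instance
      m-nonZero : ℕ.NonZero m
      m-nonZero = ℕ.>-nonZero 1≤m

    h≢1 : h ≢ 1
    h≢1 = ≡.≢-sym (ℕ.<⇒≢ 2≤h)

    h<2h : h ℕ.< 2 ℕ.* h
    h<2h = ℕ.<-≤-trans (ℕ.m<m+n h (ℕ.<-trans (ℕ.s≤s ℕ.z≤n) 2≤h)) (ℕ.+-monoʳ-≤ h (ℕ.m≤m+n h 0))

    k+k≡l+m : + k + + k ≡ + l + + m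
    k+k≡l+m = ≡.cong +_ (≡.trans (≡.cong (k ℕ.+_) (≡.sym (ℕ.+-identityʳ k))) (≡.sym l+m≡2k))

    cancel-m : ∀ q q′ → q * + m ≡ q′ * + m → q ≡ q′
    cancel-m q q′ = ℤ.*-cancelʳ-≡ q q′ (+ m)

    add-unit-multiple : ∀ a b → a ≡ (a - 1ℤ * b) + b
    add-unit-multiple = solve-∀

    minus-unit : ∀ a b {c} → a - 1ℤ * b ≡ c → a ≡ c + b
    minus-unit a b a-b≡c = ≡.trans (add-unit-multiple a b) (≡.cong (_+ b) a-b≡c)

    minus-negative-unit : ∀ a b → a - -1ℤ * b ≡ a + b
    minus-negative-unit = solve-∀

    add-back : ∀ a b → b ≡ (- a + b) + a
    add-back = solve-∀

    negative-multiple : ∀ j → - + (suc j ℕ.* h) ≡ -[1+ j ] * + h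
    negative-multiple j = ≡.trans (≡.cong -_ (ℤ.pos-* (suc j) h)) (ℤ.neg-distribˡ-* (+ suc j) (+ h))

  multiple-of-h : ∀ p {a} → p * + h ≡ + a → a ℕ.< 2 ℕ.* h → a ≡ 0 ⊎ a ≡ h
  multiple-of-h p {a} p*h≡a a<2h =
    multiple ∣ p ∣ (≡.trans (≡.sym (ℤ.abs-* p (+ h))) (≡.cong ∣_∣ p*h≡a))
    where
    multiple : ∀ j → j ℕ.* h ≡ a → a ≡ 0 ⊎ a ≡ h
    multiple 0             ≡.refl = inj₁ ≡.refl
    multiple 1             ≡.refl = inj₂ (ℕ.+-identityʳ h)
    multiple (suc (suc j)) ≡.refl =
      ⊥-elim (ℕ.<⇒≱ a<2h (ℕ.+-monoʳ-≤ h (ℕ.+-monoʳ-≤ h ℕ.z≤n)))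

  unit-coefficient : ∀ q {u} → ∣ u ∣ ≡ 1 → q * + m ≡ u → m ≡ 1 × q ≡ u
  unit-coefficient q ∣u∣≡1 q*m≡u =
    m≡1 , ≡.trans (≡.sym (ℤ.*-identityʳ q)) (≡.subst (λ j → q * + j ≡ _) m≡1 q*m≡u)
    where
    m≡1 : m ≡ 1
    m≡1 = ℕ.m*n≡1⇒n≡1 ∣ q ∣ m
            (≡.trans (≡.sym (ℤ.abs-* q (+ m))) (≡.trans (≡.cong ∣_∣ q*m≡u) ∣u∣≡1))

  ¬InLattice[1,0] : ¬ InLattice (1ℤ , 0ℤ)
  ¬InLattice[1,0] (p , q , e₁ , q*m≡0) with cancel-m q 0ℤ q*m≡0
  ... | ≡.refl =
    [ (λ ()) , h≢1 ∘ ≡.sym ]′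
      (multiple-of-h p (≡.trans (≡.sym (ℤ.+-identityʳ (p * + h))) e₁) (ℕ.<-trans 2≤h h<2h))

  private
    l+1≡2k : m ≡ 1 → l ℕ.+ 1 ≡ 2 ℕ.* k
    l+1≡2k m≡1 = ≡.trans (≡.cong (l ℕ.+_) (≡.sym m≡1)) l+m≡2k

    k≤h : m ≡ 1 → k ℕ.≤ h
    k≤h m≡1 = ℕ.*-cancelˡ-≤ 2 (≡.subst (ℕ._≤ 2 ℕ.* h) (≡.trans (ℕ.+-comm 1 l) (l+1≡2k m≡1)) l<2h)

    k≢0 : m ≡ 1 → k ≢ 0
    k≢0 m≡1 k≡0 with ≡.trans (≡.trans (ℕ.+-comm 1 l) (l+1≡2k m≡1)) (≡.cong (2 ℕ.*_) k≡0)
    ... | ()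

  InLattice[0,1]⇒ : InLattice (0ℤ , 1ℤ) → m ≡ 1 × l ℕ.+ 1 ≡ 2 ℕ.* h
  InLattice[0,1]⇒ (p , q , e₁ , q*m≡1) with unit-coefficient q ≡.refl q*m≡1
  ... | m≡1 , ≡.refl with multiple-of-h p (minus-unit (p * + h) (+ k) e₁) (ℕ.≤-<-trans (k≤h m≡1) h<2h)
  ...   | inj₁ k≡0 = ⊥-elim (k≢0 m≡1 k≡0)
  ...   | inj₂ k≡h = m≡1 , ≡.trans (l+1≡2k m≡1) (≡.cong (2 ℕ.*_) k≡h)

  InLattice[1,-1]⇒ : InLattice (1ℤ , -1ℤ) → m ≡ 1 × l ≡ 1
  InLattice[1,-1]⇒ (p , q , e₁ , q*m≡-1) with unit-coefficient q ≡.refl q*m≡-1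
  ... | m≡1 , ≡.refl = m≡1 , ℕ.+-cancelʳ-≡ 1 l 1 (≡.trans (l+1≡2k m≡1) (≡.cong (2 ℕ.*_) k≡1))
    where
    k≡1-if : ∀ p → p * + h + + k ≡ 1ℤ → k ≡ 1
    k≡1-if (+ zero) e = ℤ.+-injective e
    k≡1-if +[1+ j ] e = ⊥-elim (h≢1 (ℕ.≤-antisym h≤1 (ℕ.<⇒≤ 2≤h)))
      where
      h≤1 : h ℕ.≤ 1
      h≤1 = ≡.subst (h ℕ.≤_) (ℤ.+-injective (≡.trans (≡.cong (_+ + k) (ℤ.pos-* (suc j) h)) e))
                    (ℕ.≤-trans (ℕ.m≤m+n h (j ℕ.* h)) (ℕ.m≤m+n _ k))
    k≡1-if -[1+ j ] e = ⊥-elim (ℕ.<⇒≱ h<k (k≤h m≡1))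
      where
      k≡1+jh : + k ≡ 1ℤ + + (suc j ℕ.* h)
      k≡1+jh = ≡.trans (add-back (+ (suc j ℕ.* h)) (+ k))
                       (≡.cong (_+ + (suc j ℕ.* h)) (≡.trans (≡.cong (_+ + k) (negative-multiple j)) e))
      h<k : h ℕ.< k
      h<k = ≡.subst (h ℕ.<_) (≡.sym (ℤ.+-injective k≡1+jh)) (ℕ.s≤s (ℕ.m≤m+n h (j ℕ.* h)))

    k≡1 : k ≡ 1
    k≡1 = k≡1-if p (≡.trans (≡.sym (minus-negative-unit (p * + h) (+ k))) e₁)

  InLattice[k-m,m]⇒ : InLattice (+ k - + m , + m) → l ≡ 0 ⊎ l ≡ h
  InLattice[k-m,m]⇒ (p , q , e₁ , q*m≡m) with cancel-m q 1ℤ (≡.trans q*m≡m (≡.sym (ℤ.*-identityˡ (+ m))))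
  ... | ≡.refl = multiple-of-h p p*h≡l l<2h
    where
    p*h≡l : p * + h ≡ + l
    p*h≡l = begin
      p * + h               ≡⟨ minus-unit (p * + h) (+ k) e₁ ⟩
      (+ k - + m) + + k     ≡⟨ rearrange (+ k) (+ m) ⟩
      (+ k + + k) - + m     ≡⟨ ≡.cong (_- + m) k+k≡l+m ⟩
      (+ l + + m) - + m     ≡⟨ cancel-difference (+ l) (+ m) ⟨
      + l                   ∎
      where
      rearrange : ∀ a b → (a - b) + a ≡ (a + a) - b
      rearrange = solve-∀
      cancel-difference : ∀ a b → a ≡ (a + b) - b
      cancel-difference = solve-∀

  InLattice[m,-k]⇒l≢0 : InLattice (+ m , - + k) → l ≢ 0
  InLattice[m,-k]⇒l≢0 (_ , q , _ , q*m≡-k) l≡0 = odd≢0 q (cancel-m (q + q + 1ℤ) 0ℤ (begin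
    (q + q + 1ℤ) * + m              ≡⟨ distrib q (+ m) ⟩
    q * + m + q * + m + + m         ≡⟨ ≡.cong₂ (λ a b → a + a + b) q*m≡-k m≡k+k ⟩
    - + k + - + k + (+ k + + k)     ≡⟨ cancel (+ k) ⟩
    0ℤ                              ∎))
    where
    m≡k+k : + m ≡ + k + + k
    m≡k+k = ≡.sym (≡.trans k+k≡l+m (≡.cong (λ j → + j + + m) l≡0))
    distrib : ∀ q m → (q + q + 1ℤ) * m ≡ q * m + q * m + m
    distrib = solve-∀
    cancel : ∀ a → - a + - a + (a + a) ≡ 0ℤ
    cancel = solve-∀
    odd≢0 : ∀ q → q + q + 1ℤ ≢ 0ℤ
    odd≢0 (+ j) e with ≡.trans (ℕ.+-comm 1 (j ℕ.+ j)) (ℤ.+-injective e)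
    ... | ()
    odd≢0 -[1+ j ] ()

  private
    divisor-of-three : ∀ r w → r * w ≡ + 3 → ∣ r ∣ ≡ 1 ⊎ ∣ r ∣ ≡ 3
    divisor-of-three r w r*w≡3 = prime⇒irreducible (from-yes (prime? 3)) (divides ∣ w ∣ 3≡∣w∣*∣r∣)
      where
      open import Data.Nat.Divisibility using (divides)
      open import Data.Nat.Primality using (prime?; prime⇒irreducible)
      open import Relation.Nullary.Decidable using (from-yes)
      3≡∣w∣*∣r∣ : 3 ≡ ∣ w ∣ ℕ.* ∣ r ∣
      3≡∣w∣*∣r∣ = ≡.trans (≡.cong ∣_∣ (≡.sym r*w≡3)) (≡.trans (ℤ.abs-* r w) (ℕ.*-comm ∣ r ∣ ∣ w ∣))

    module _ {p q r} (l≡h : l ≡ h) (r*m≡h : r * + m ≡ + h) (q*m≡-k : q * + m ≡ - + k)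
             (p*h-q*k≡m : p * + h - q * + k ≡ + m) where

      r≡-2q-1 : r ≡ - q - q - 1ℤ
      r≡-2q-1 = begin
        r                                   ≡⟨ isolate r q ⟩
        (r + q + q + 1ℤ) + (- q - q - 1ℤ)   ≡⟨ ≡.cong (_+ (- q - q - 1ℤ)) [r+2q+1]≡0 ⟩
        0ℤ + (- q - q - 1ℤ)                 ≡⟨ ℤ.+-identityˡ _ ⟩
        - q - q - 1ℤ                        ∎
        where
        isolate : ∀ r q → r ≡ (r + q + q + 1ℤ) + (- q - q - 1ℤ)
        isolate = solve-∀
        distrib : ∀ r q m → (r + q + q + 1ℤ) * m ≡ r * m + q * m + q * m + m
        distrib = solve-∀
        regroup : ∀ h k m → h + - k + - k + m ≡ (h + m) - (k + k)
        regroup = solve-∀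
        [r+2q+1]≡0 : r + q + q + 1ℤ ≡ 0ℤ
        [r+2q+1]≡0 = cancel-m (r + q + q + 1ℤ) 0ℤ (begin
          (r + q + q + 1ℤ) * + m              ≡⟨ distrib r q (+ m) ⟩
          r * + m + q * + m + q * + m + + m    ≡⟨ ≡.cong₂ (λ a b → a + b + b + + m) r*m≡h q*m≡-k ⟩
          + h + - + k + - + k + + m           ≡⟨ regroup (+ h) (+ k) (+ m) ⟩
          (+ h + + m) - (+ k + + k)           ≡⟨ ≡.cong (λ j → (+ j + + m) - (+ k + + k)) (≡.sym l≡h) ⟩
          (+ l + + m) - (+ k + + k)           ≡⟨ ≡.cong (λ a → (+ l + + m) - a) k+k≡l+m ⟩
          (+ l + + m) - (+ l + + m)           ≡⟨ ℤ.+-inverseʳ (+ l + + m) ⟩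
          0ℤ                                  ∎)

      pr+q²≡1 : p * r + q * q ≡ 1ℤ
      pr+q²≡1 = cancel-m (p * r + q * q) 1ℤ (begin
        (p * r + q * q) * + m            ≡⟨ expand p r q (+ m) ⟩
        p * (r * + m) - q * - (q * + m)  ≡⟨ ≡.cong₂ (λ a b → p * a - q * - b) r*m≡h q*m≡-k ⟩
        p * + h - q * - - + k            ≡⟨ ≡.cong (λ a → p * + h - q * a) (ℤ.neg-involutive (+ k)) ⟩
        p * + h - q * + k                ≡⟨ p*h-q*k≡m ⟩
        + m                              ≡⟨ ℤ.*-identityˡ (+ m) ⟨
        1ℤ * + m                         ∎)
        where
        expand : ∀ p r q m → (p * r + q * q) * m ≡ p * (r * m) - q * - (q * m)
        expand = solve-∀

      -- completing the square: with r = - 2q - 1, r (4p + r + 2) = 4 (pr + q²) - 1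
      r*[4p+r+2]≡3 : r * (+ 4 * p + r + + 2) ≡ + 3
      r*[4p+r+2]≡3 = begin
        r * (+ 4 * p + r + + 2)                       ≡⟨ ≡.cong (λ r → r * (+ 4 * p + r + + 2)) r≡-2q-1 ⟩
        (- q - q - 1ℤ) * (+ 4 * p + (- q - q - 1ℤ) + + 2) ≡⟨ complete-square p q ⟩
        + 4 * (p * (- q - q - 1ℤ) + q * q) - 1ℤ       ≡⟨ ≡.cong (λ r → + 4 * (p * r + q * q) - 1ℤ) r≡-2q-1 ⟨
        + 4 * (p * r + q * q) - 1ℤ                    ≡⟨ ≡.cong (λ a → + 4 * a - 1ℤ) pr+q²≡1 ⟩
        + 3                                           ∎
        where
        complete-square : ∀ p q → (- q - q - 1ℤ) * (+ 4 * p + (- q - q - 1ℤ) + + 2)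
                                  ≡ + 4 * (p * (- q - q - 1ℤ) + q * q) - 1ℤ
        complete-square = solve-∀

  InLattice[0,h]∧[m,-k]⇒ : l ≡ h → InLattice (0ℤ , + h) → InLattice (+ m , - + k) → l ≡ m ⊎ l ≡ 3 ℕ.* m
  InLattice[0,h]∧[m,-k]⇒ l≡h (_ , r , _ , r*m≡h) (p , q , p*h-q*k≡m , q*m≡-k) =
    map (λ ∣r∣≡1 → ≡.trans (l≡∣r∣*m ∣r∣≡1) (ℕ.*-identityˡ m)) l≡∣r∣*m
        (divisor-of-three r (+ 4 * p + r + + 2) (r*[4p+r+2]≡3 {p} {q} {r} l≡h r*m≡h q*m≡-k p*h-q*k≡m))
    where
    l≡∣r∣*m : ∀ {j} → ∣ r ∣ ≡ j → l ≡ j ℕ.* m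
    l≡∣r∣*m ≡.refl = ≡.trans l≡h (≡.trans (≡.cong ∣_∣ (≡.sym r*m≡h)) (ℤ.abs-* r (+ m)))

  InLattice-conditions⇒ : InLattice (0ℤ , + h) → InLattice (+ m , - + k) → InLattice (+ k - + m , + m) →
                          l ≡ h × (l ≡ m ⊎ l ≡ 3 ℕ.* m)
  InLattice-conditions⇒ [0,h] [m,-k] [k-m,m] = l≡h , InLattice[0,h]∧[m,-k]⇒ l≡h [0,h] [m,-k]
    where
    l≡h : l ≡ h
    l≡h = [ ⊥-elim ∘ InLattice[m,-k]⇒l≢0 [m,-k] , (λ l≡h → l≡h) ]′ (InLattice[k-m,m]⇒ [k-m,m])

module Model (n m l : ℕ) (c ℓ : Level) where
  open import Data.Integer using (+_; -_; _+_; _*_; _-_; 0ℤ; 1ℤ; -1ℤ)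
  import Data.Integer.Properties as ℤ
  open import Data.Integer.Tactic.RingSolver using (solve-∀)

  h k : ℕ
  h = n ℕ./ 2
  k = (l ℕ.+ m) ℕ./ 2

  open LatticeQuotient (+ h) (+ k) (+ m) public
  open Dihedral (ℤ²/lattice c ℓ) using (dihedral; rotation-^; _·_)

  model : Group c ℓ
  model = dihedral

  open Group model hiding (_-_)
  open Powers model using (^-congˡ)

  T X Y : Carrier
  T = true  , lift (0ℤ , 0ℤ)
  X = false , lift (1ℤ , 0ℤ)
  Y = false , lift (0ℤ , 1ℤ)

  private
    ·-lift : ∀ j u → lower (j · lift u) ≡ + j ⊛ u
    ·-lift zero    (a , b) = ≡.refl
    ·-lift (suc j) (a , b) rewrite ·-lift j (a , b) =
      ≡.sym (≡.cong₂ _,_ (ℤ.suc-* (+ j) a) (ℤ.suc-* (+ j) b))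

    rotation-^ℤ : ∀ u j → pow model (false , lift u) j ≈ (false , lift (+ j ⊛ u))
    rotation-^ℤ u j = trans (rotation-^ (lift u) j) (≡.refl , lift (≡⇒∼ (·-lift j u)))

  rotations-≈ : ∀ {u v} → (false , lift u) ≈ (false , lift v) → InLattice (u ⊕ ⊖ v)
  rotations-≈ (_ , u∼v) = difference (lower u∼v)

  rotation-powers-≈ : ∀ u v i j → pow model (false , lift u) i ≈ pow model (false , lift v) j →
                      InLattice (+ i ⊛ u ⊕ ⊖ (+ j ⊛ v))
  rotation-powers-≈ u v i j uⁱ≈vʲ =
    rotations-≈ (trans (sym (rotation-^ℤ u i)) (trans uⁱ≈vʲ (rotation-^ℤ v j)))

  model-relations : Rels model n m l T X Y
  model-relations =
      refl
    , trans (rotation-^ℤ (1ℤ , 0ℤ) h)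
        (≡.refl , lift (congruent (1ℤ , 0ℤ , x-span (+ h) (+ k) , x-zero (+ h) (+ m))))
    , trans (rotation-^ℤ (0ℤ , 1ℤ) m)
        (trans (≡.refl , lift (congruent (0ℤ , 1ℤ , y-span (+ h) (+ k) (+ m) , y-span₂ (+ k) (+ m))))
               (sym (rotation-^ℤ (1ℤ , 0ℤ) k)))
    , refl , refl , refl
    where
    x-span : ∀ h k → 1ℤ * h - 0ℤ * k ≡ h * 1ℤ + - 0ℤ
    x-span = solve-∀
    x-zero : ∀ h m → 0ℤ * m ≡ h * 0ℤ + - 0ℤ
    x-zero = solve-∀
    y-span : ∀ h k m → 0ℤ * h - 1ℤ * k ≡ m * 0ℤ + - (k * 1ℤ)
    y-span = solve-∀
    y-span₂ : ∀ k m → 1ℤ * m ≡ m * 1ℤ + - (k * 0ℤ)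
    y-span₂ = solve-∀

  Rels[Y,X]⇒InLattice : ∀ {t′ x′ y′} → x′ ≈ Y → y′ ≈ X → Rels model n m l t′ x′ y′ →
                   InLattice (0ℤ , + h) × InLattice (+ m , - + k)
  Rels[Y,X]⇒InLattice x′≈Y y′≈X (_ , x′ʰ≈ε , y′ᵐ≈x′ᵏ , _) =
      InLattice-resp (≡.cong₂ _,_ (times-zero (+ h)) (times-one (+ h)))
        (rotation-powers-≈ (0ℤ , 1ℤ) (0ℤ , 0ℤ) h 0 (trans (sym (^-congˡ h x′≈Y)) x′ʰ≈ε))
    , InLattice-resp (≡.cong₂ _,_ (one-minus-zero (+ m) (+ k)) (zero-minus-one (+ m) (+ k)))
        (rotation-powers-≈ (1ℤ , 0ℤ) (0ℤ , 1ℤ) m k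
          (trans (sym (^-congˡ m y′≈X)) (trans y′ᵐ≈x′ᵏ (^-congˡ k x′≈Y))))
    where
    times-zero : ∀ a → a * 0ℤ + - 0ℤ ≡ 0ℤ
    times-zero = solve-∀
    times-one : ∀ a → a * 1ℤ + - 0ℤ ≡ a
    times-one = solve-∀
    one-minus-zero : ∀ a b → a * 1ℤ + - (b * 0ℤ) ≡ a
    one-minus-zero = solve-∀
    zero-minus-one : ∀ a b → a * 0ℤ + - (b * 1ℤ) ≡ - b
    zero-minus-one = solve-∀

  Rels[X⁻¹,X⁻¹Y]⇒InLattice : ∀ {t′ x′ y′} → x′ ≈ X ⁻¹ → y′ ≈ X ⁻¹ ∙ Y → Rels model n m l t′ x′ y′ →
                   InLattice (+ k - + m , + m)
  Rels[X⁻¹,X⁻¹Y]⇒InLattice x′≈X⁻¹ y′≈X⁻¹Y (_ , _ , y′ᵐ≈x′ᵏ , _) =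
    InLattice-resp (≡.cong₂ _,_ (first (+ m) (+ k)) (second (+ m) (+ k)))
      (rotation-powers-≈ (-1ℤ , 1ℤ) (-1ℤ , 0ℤ) m k
        (trans (sym (^-congˡ m y′≈X⁻¹Y)) (trans y′ᵐ≈x′ᵏ (^-congˡ k x′≈X⁻¹))))
    where
    first : ∀ a b → a * -1ℤ + - (b * -1ℤ) ≡ b - a
    first = solve-∀
    second : ∀ a b → a * 1ℤ + - (b * 0ℤ) ≡ a
    second = solve-∀

module S₃ where
  open import Data.Fin using (Fin; punchOut)
  open import Data.Fin.Patterns using (0F; 1F; 2F; 3F; 4F; 5F)
  open import Data.Fin.Properties using (_≟_; all?; any?; pigeonhole; punchOut-injective; <-irrefl)
  open import Relation.Nullary using (¬_; yes; no)
  import Data.Nat.Properties as ℕ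

  private
    missed : ∀ {n} {f : Fin n → Fin n} {c} → ¬ (∃ λ i → f i ≡ c) → ∀ i → c ≢ f i
    missed miss i c≡fi = miss (i , ≡.sym c≡fi)

  injective⇒surjective : ∀ {n} (f : Fin n → Fin n) → (∀ i j → f i ≡ f j → i ≡ j) → ∀ c → ∃ λ i → f i ≡ c
  injective⇒surjective {suc n} f f-injective c with any? (λ i → f i ≟ c)
  ... | yes hit = hit
  ... | no  miss with pigeonhole (ℕ.n<1+n n) (λ i → punchOut (missed miss i))
  ...   | i , j , i<j , same =
    ⊥-elim (<-irrefl (f-injective i j (punchOut-injective (missed miss i) (missed miss j) same)) i<j)

  open import Data.Fin.Permutation using (Permutation′; permutation)
  open import Data.Vec using (Vec; []; _∷_; lookup)
  open import Relation.Nullary.Decidable using (from-yes; ¬?; _→-dec_)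

  images : Fin 6 → Vec (Fin 3) 3
  images 0F = 0F ∷ 1F ∷ 2F ∷ []
  images 1F = 0F ∷ 2F ∷ 1F ∷ []
  images 2F = 1F ∷ 0F ∷ 2F ∷ []
  images 3F = 1F ∷ 2F ∷ 0F ∷ []
  images 4F = 2F ∷ 0F ∷ 1F ∷ []
  images 5F = 2F ∷ 1F ∷ 0F ∷ []

  table : Fin 6 → Fin 3 → Fin 3
  table j = lookup (images j)

  inverse : Fin 6 → Fin 6
  inverse 3F = 4F
  inverse 4F = 3F
  inverse j  = j

  perm : Fin 6 → Permutation′ 3
  perm j = permutation (table j) (table (inverse j)) (right j) (left j)
    where
    right : ∀ j i → table j (table (inverse j) i) ≡ i
    right = from-yes (all? λ j → all? λ i → table j (table (inverse j) i) ≟ i)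
    left : ∀ j i → table (inverse j) (table j i) ≡ i
    left = from-yes (all? λ j → all? λ i → table (inverse j) (table j i) ≟ i)

  private
    index : Fin 3 → Fin 3 → Fin 6
    index 0F 2F = 1F
    index 1F 0F = 2F
    index 1F 2F = 3F
    index 2F 0F = 4F
    index 2F 1F = 5F
    index _  _  = 0F

  -- a permutation of Fin 3 is determined by the images of 0F and 1F;
  -- non-injective maps are sent to 0F
  code : (Fin 3 → Fin 3) → Fin 6
  code f = index (f 0F) (f 1F)

  code-cong : ∀ {f g} → (∀ i → f i ≡ g i) → code f ≡ code g
  code-cong f≗g = ≡.cong₂ index (f≗g 0F) (f≗g 1F)

  table-0F : ∀ i → i ≡ table 0F i
  table-0F = from-yes (all? λ i → i ≟ table 0F i)

  table-3F : ∀ i → table 2F (table 1F i) ≡ table 3F i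
  table-3F = from-yes (all? λ i → table 2F (table 1F i) ≟ table 3F i)

  table-4F : ∀ i → table 1F (table 2F i) ≡ table 4F i
  table-4F = from-yes (all? λ i → table 1F (table 2F i) ≟ table 4F i)

  table-5F : ∀ i → table 1F (table 2F (table 1F i)) ≡ table 5F i
  table-5F = from-yes (all? λ i → table 1F (table 2F (table 1F i)) ≟ table 5F i)

  code-table : ∀ j → code (table j) ≡ j
  code-table = from-yes (all? λ j → code (table j) ≟ j)

  table-code : (f : Fin 3 → Fin 3) → (∀ i j → f i ≡ f j → i ≡ j) → ∀ i → table (code f) i ≡ f i
  table-code f f-injective i =
    ≡.trans (decode (f 0F) (f 1F) (f 2F) (distinct λ ()) (distinct λ ()) (distinct λ ()) i) (triple-f i)
    where
    triple : Fin 3 → Fin 3 → Fin 3 → Fin 3 → Fin 3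
    triple a b c 0F = a
    triple a b c 1F = b
    triple a b c 2F = c

    decode : ∀ a b c → a ≢ b → a ≢ c → b ≢ c → ∀ i → table (code (triple a b c)) i ≡ triple a b c i
    decode = from-yes (all? λ a → all? λ b → all? λ c →
      ¬? (a ≟ b) →-dec ¬? (a ≟ c) →-dec ¬? (b ≟ c) →-dec all? λ i → table (code (triple a b c)) i ≟ triple a b c i)

    triple-f : ∀ i → triple (f 0F) (f 1F) (f 2F) i ≡ f i
    triple-f 0F = ≡.refl
    triple-f 1F = ≡.refl
    triple-f 2F = ≡.refl

    distinct : ∀ {i j} → i ≢ j → f i ≢ f j
    distinct i≢j fi≡fj = i≢j (f-injective _ _ fi≡fj)

module AutomorphismsOfGenerators {c ℓ} (G : Group c ℓ) (t x y : Group.Carrier G) where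
  open import Relation.Nullary using (¬_)
  open import Data.Fin using (Fin)
  open import Data.Fin.Patterns using (0F; 1F; 2F; 3F; 4F; 5F)
  open S₃ using ( perm; table; code; code-cong; code-table; table-code; injective⇒surjective
                ; table-0F; table-3F; table-4F; table-5F)
  open import Function using (_∘_)
  import Algebra.Morphism.Construct.Identity as Identity
  import Algebra.Morphism.Construct.Composition as Composition
  open Group G
  open GroupMorphisms rawGroup rawGroup
  open AutS

  Aut : Set (c Level.⊔ ℓ)
  Aut = AutS G t x y

  s : Fin 3 → Carrier
  s 0F = t
  s 1F = t ∙ x
  s 2F = t ∙ y

  ≡⇒≈s : ∀ {i j} → i ≡ j → s i ≈ s j
  ≡⇒≈s ≡.refl = refl

  Realizes : (Carrier → Carrier) → (Fin 3 → Fin 3) → Set ℓ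
  Realizes F σ = ∀ i → F (s i) ≈ s (σ i)

  Realizes-≗ : ∀ {F σ σ′} → (∀ i → σ i ≡ σ′ i) → Realizes F σ → Realizes F σ′
  Realizes-≗ σ≗σ′ F↦σ i = trans (F↦σ i) (≡⇒≈s (σ≗σ′ i))

  s-injective : ¬ (t ≈ t ∙ x) → ¬ (t ∙ y ≈ t ⊎ t ∙ y ≈ t ∙ x) → ∀ {i j} → s i ≈ s j → i ≡ j
  s-injective t≉tx ty∉S₂ {0F} {0F} _    = ≡.refl
  s-injective t≉tx ty∉S₂ {0F} {1F} t≈tx = ⊥-elim (t≉tx t≈tx)
  s-injective t≉tx ty∉S₂ {0F} {2F} t≈ty = ⊥-elim (ty∉S₂ (inj₁ (sym t≈ty)))
  s-injective t≉tx ty∉S₂ {1F} {0F} tx≈t = ⊥-elim (t≉tx (sym tx≈t))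
  s-injective t≉tx ty∉S₂ {1F} {1F} _    = ≡.refl
  s-injective t≉tx ty∉S₂ {1F} {2F} tx≈ty = ⊥-elim (ty∉S₂ (inj₂ (sym tx≈ty)))
  s-injective t≉tx ty∉S₂ {2F} {0F} ty≈t = ⊥-elim (ty∉S₂ (inj₁ ty≈t))
  s-injective t≉tx ty∉S₂ {2F} {1F} ty≈tx = ⊥-elim (ty∉S₂ (inj₂ ty≈tx))
  s-injective t≉tx ty∉S₂ {2F} {2F} _    = ≡.refl

  InS-s : ∀ {g} i → g ≈ s i → InS G t x y g
  InS-s 0F g≈t  = inj₁ g≈t
  InS-s 1F g≈tx = inj₂ (inj₁ g≈tx)
  InS-s 2F g≈ty = inj₂ (inj₂ g≈ty)

  index : ∀ {g} → InS G t x y g → Fin 3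
  index (inj₁ _)        = 0F
  index (inj₂ (inj₁ _)) = 1F
  index (inj₂ (inj₂ _)) = 2F

  ≈-index : ∀ {g} (g∈S : InS G t x y g) → g ≈ s (index g∈S)
  ≈-index (inj₁ g≈t)         = g≈t
  ≈-index (inj₂ (inj₁ g≈tx)) = g≈tx
  ≈-index (inj₂ (inj₂ g≈ty)) = g≈ty

  act : Aut → Fin 3 → Fin 3
  act α i = index (into α (s i) (InS-s i refl))

  act-realizes : (α : Aut) → Realizes (fun α) (act α)
  act-realizes α i = ≈-index (into α (s i) (InS-s i refl))

  isHom : (α : Aut) → IsGroupHomomorphism (fun α)
  isHom α = IsGroupIsomorphism.isGroupHomomorphism (isAut α)

  id : Aut
  id = record
    { fun   = λ g → g
    ; isAut = Identity.isGroupIsomorphism rawGroup refl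
    ; into  = λ _ g∈S → g∈S
    ; onto  = λ g g∈S → g , g∈S , refl }

  infixr 9 _∘ᴬ_
  _∘ᴬ_ : Aut → Aut → Aut
  α ∘ᴬ β = record
    { fun   = fun α ∘ fun β
    ; isAut = Composition.isGroupIsomorphism trans (isAut β) (isAut α)
    ; into  = λ g g∈S → into α (fun β g) (into β g g∈S)
    ; onto  = onto-∘ }
    where
    onto-∘ : ∀ g → InS G t x y g → ∃ λ g′ → InS G t x y g′ × fun α (fun β g′) ≈ g
    onto-∘ g g∈S with onto α g g∈S
    ... | g′ , g′∈S , αg′≈g with onto β g′ g′∈S
    ... | g″ , g″∈S , βg″≈g′ = g″ , g″∈S , trans (IsGroupHomomorphism.⟦⟧-cong (isHom α) βg″≈g′) αg′≈g

  Realizes-∘ : ∀ {α β : Aut} {σ τ} → Realizes (fun α) σ → Realizes (fun β) τ → Realizes (fun (α ∘ᴬ β)) (σ ∘ τ)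
  Realizes-∘ {α} {β} {σ} {τ} α↦σ β↦τ i =
    trans (IsGroupHomomorphism.⟦⟧-cong (isHom α) (β↦τ i)) (α↦σ (τ i))

  involution : ∀ {F σ} → IsGroupHomomorphism F → (∀ g → F (F g) ≈ g) → Realizes F σ → Aut
  involution {F} {σ} F-hom F∘F≈id F↦σ = record
    { fun   = F
    ; isAut = record
      { isGroupMonomorphism = record
        { isGroupHomomorphism = F-hom
        ; injective = λ {g} {g′} Fg≈Fg′ → trans (sym (F∘F≈id g)) (trans (F-cong Fg≈Fg′) (F∘F≈id g′)) }
      ; surjective = λ g → F g , λ g′≈Fg → trans (F-cong g′≈Fg) (F∘F≈id g) }
    ; into  = into-F
    ; onto  = λ g g∈S → F g , into-F g g∈S , F∘F≈id g }
    where
    F-cong : ∀ {g g′} → g ≈ g′ → F g ≈ F g′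
    F-cong = IsGroupHomomorphism.⟦⟧-cong F-hom
    into-F : ∀ g → InS G t x y g → InS G t x y (F g)
    into-F g g∈S = InS-s (σ (index g∈S)) (trans (F-cong (≈-index g∈S)) (F↦σ (index g∈S)))

  sixAutomorphisms : AutS≅S₃ G t x y → Fin 6 → Aut
  sixAutomorphisms (_ , ψ , _) j = ψ (perm j)

  sixAutomorphisms-distinct : ∀ iso i j → _≈A_ G t x y (sixAutomorphisms iso i) (sixAutomorphisms iso j) → i ≡ j
  sixAutomorphisms-distinct (φ , ψ , φ-cong , φψ , _) i j αi≈αj =
    ≡.trans (≡.sym (code-table i)) (≡.trans (code-cong same-table) (code-table j))
    where
    same-table : ∀ k → table i k ≡ table j k
    same-table k = ≡.trans (≡.sym (φψ (perm i) k)) (≡.trans (φ-cong _ _ αi≈αj k) (φψ (perm j) k))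

  realized-from-transpositions : (Σ Aut λ α → Realizes (fun α) (table 1F)) →
                                 (Σ Aut λ α → Realizes (fun α) (table 2F)) →
                                 ∀ j → Σ Aut λ α → Realizes (fun α) (table j)
  realized-from-transpositions _ _ 0F = id , Realizes-≗ {F = λ g → g} {σ = λ i → i} table-0F (λ _ → refl)
  realized-from-transpositions σ _ 1F = σ
  realized-from-transpositions _ φ 2F = φ
  realized-from-transpositions (σ , σ↦) (φ , φ↦) 3F =
    φ ∘ᴬ σ , Realizes-≗ {F = fun (φ ∘ᴬ σ)} table-3F (Realizes-∘ {φ} {σ} {table 2F} {table 1F} φ↦ σ↦)
  realized-from-transpositions (σ , σ↦) (φ , φ↦) 4F =
    σ ∘ᴬ φ , Realizes-≗ {F = fun (σ ∘ᴬ φ)} table-4F (Realizes-∘ {σ} {φ} {table 1F} {table 2F} σ↦ φ↦)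
  realized-from-transpositions (σ , σ↦) (φ , φ↦) 5F =
    σ ∘ᴬ φ ∘ᴬ σ , Realizes-≗ {F = fun (σ ∘ᴬ φ ∘ᴬ σ)} table-5F
      (Realizes-∘ {σ} {φ ∘ᴬ σ} {table 1F} {table 2F ∘ table 1F} σ↦
        (Realizes-∘ {φ} {σ} {table 2F} {table 1F} φ↦ σ↦))

  module Generated
    (generated : ∀ {F F′} → IsGroupHomomorphism F → IsGroupHomomorphism F′ →
                 F t ≈ F′ t → F x ≈ F′ x → F y ≈ F′ y → ∀ g → F g ≈ F′ g)
    where

    agree-on-S : ∀ {F F′} → IsGroupHomomorphism F → IsGroupHomomorphism F′ →
                 (∀ i → F (s i) ≈ F′ (s i)) → ∀ g → F g ≈ F′ g
    agree-on-S {F} {F′} F-hom F′-hom F≈F′ =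
      generated F-hom F′-hom (F≈F′ 0F) (translate x (F≈F′ 1F)) (translate y (F≈F′ 2F))
      where
      translate : ∀ g → F (t ∙ g) ≈ F′ (t ∙ g) → F g ≈ F′ g
      translate g F≈F′ₜ = trans (⟦⟧-translate {G = G} {H = G} F-hom t g)
                            (trans (∙-cong (⁻¹-cong (F≈F′ 0F)) F≈F′ₜ) (sym (⟦⟧-translate {G = G} {H = G} F′-hom t g)))

    ≈ᴬ-on-S : ∀ (α β : Aut) → (∀ i → fun α (s i) ≈ fun β (s i)) → _≈A_ G t x y α β
    ≈ᴬ-on-S α β = agree-on-S (isHom α) (isHom β)

    module Distinct (s-injective : ∀ {i j} → s i ≈ s j → i ≡ j) where
      open import Data.Fin.Permutation using (Permutation′; _⟨$⟩ʳ_)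
      open import Function.Bundles using (Injection)
      open import Function.Properties.Inverse using (↔⇒↣)

      act-unique : ∀ (α : Aut) σ → Realizes (fun α) σ → ∀ i → act α i ≡ σ i
      act-unique α σ α↦σ i = s-injective (trans (sym (act-realizes α i)) (α↦σ i))

      act-injective : ∀ (α : Aut) i j → act α i ≡ act α j → i ≡ j
      act-injective α i j αi≡αj = s-injective (IsGroupIsomorphism.injective (isAut α)
        (trans (act-realizes α i) (trans (≡⇒≈s αi≡αj) (sym (act-realizes α j)))))

      ≈ᴬ⇒act : ∀ (α β : Aut) → _≈A_ G t x y α β → ∀ i → act α i ≡ act β i
      ≈ᴬ⇒act α β α≈β = act-unique α (act β) (λ i → trans (α≈β (s i)) (act-realizes β i))

      act⇒≈ᴬ : ∀ (α β : Aut) → (∀ i → act α i ≡ act β i) → _≈A_ G t x y α β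
      act⇒≈ᴬ α β α≗β =
        ≈ᴬ-on-S α β (λ i → trans (act-realizes α i) (trans (≡⇒≈s (α≗β i)) (sym (act-realizes β i))))

      act-∘ : ∀ α β γ → IsComp G t x y γ α β → ∀ i → act γ i ≡ act α (act β i)
      act-∘ α β γ γ≈αβ = act-unique γ (λ i → act α (act β i)) λ i →
        trans (γ≈αβ (s i)) (Realizes-∘ {α} {β} {act α} {act β} (act-realizes α) (act-realizes β) i)

      toPerm : Aut → Permutation′ 3
      toPerm α = perm (code (act α))

      toPerm-act : ∀ α i → toPerm α ⟨$⟩ʳ i ≡ act α i
      toPerm-act α = table-code (act α) (act-injective α)

      AutS≅S₃-if-realized : (∀ j → Σ Aut λ α → Realizes (fun α) (table j)) → AutS≅S₃ G t x y
      AutS≅S₃-if-realized realize =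
        toPerm , fromPerm , toPerm-cong , toPerm-fromPerm , fromPerm-toPerm , toPerm-∘
        where
        fromPerm : Permutation′ 3 → Aut
        fromPerm π = proj₁ (realize (code (π ⟨$⟩ʳ_)))

        act-fromPerm : ∀ π i → act (fromPerm π) i ≡ table (code (π ⟨$⟩ʳ_)) i
        act-fromPerm π = act-unique (fromPerm π) _ (proj₂ (realize (code (π ⟨$⟩ʳ_))))

        toPerm-cong : ∀ α β → _≈A_ G t x y α β → ∀ i → toPerm α ⟨$⟩ʳ i ≡ toPerm β ⟨$⟩ʳ i
        toPerm-cong α β α≈β i = ≡.trans (toPerm-act α i) (≡.trans (≈ᴬ⇒act α β α≈β i) (≡.sym (toPerm-act β i)))

        toPerm-fromPerm : ∀ π i → toPerm (fromPerm π) ⟨$⟩ʳ i ≡ π ⟨$⟩ʳ i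
        toPerm-fromPerm π i = ≡.trans (toPerm-act (fromPerm π) i)
          (≡.trans (act-fromPerm π i) (table-code (π ⟨$⟩ʳ_) (λ _ _ → Injection.injective (↔⇒↣ π)) i))

        fromPerm-toPerm : ∀ α → _≈A_ G t x y (fromPerm (toPerm α)) α
        fromPerm-toPerm α = act⇒≈ᴬ (fromPerm (toPerm α)) α λ i → ≡.trans (act-fromPerm (toPerm α) i)
          (≡.trans (≡.cong (λ j → table j i) (code-table (code (act α)))) (toPerm-act α i))

        toPerm-∘ : ∀ α β γ → IsComp G t x y γ α β → ∀ i → toPerm γ ⟨$⟩ʳ i ≡ toPerm α ⟨$⟩ʳ (toPerm β ⟨$⟩ʳ i)
        toPerm-∘ α β γ γ≈αβ i = ≡.trans (toPerm-act γ i) (≡.trans (act-∘ α β γ γ≈αβ i)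
          (≡.sym (≡.trans (toPerm-act α _) (≡.cong (act α) (toPerm-act β i)))))

      realized-if-AutS≅S₃ : AutS≅S₃ G t x y → ∀ j → Σ Aut λ α → Realizes (fun α) (table j)
      realized-if-AutS≅S₃ iso j = realizer (injective⇒surjective codeOf codeOf-injective j)
        where
        α : Fin 6 → Aut
        α = sixAutomorphisms iso

        codeOf : Fin 6 → Fin 6
        codeOf i = code (act (α i))

        act≡table : ∀ i k → act (α i) k ≡ table (codeOf i) k
        act≡table i k = ≡.sym (toPerm-act (α i) k)

        codeOf-injective : ∀ i i′ → codeOf i ≡ codeOf i′ → i ≡ i′
        codeOf-injective i i′ codes≡ = sixAutomorphisms-distinct iso i i′ (act⇒≈ᴬ (α i) (α i′) λ k →
          ≡.trans (act≡table i k) (≡.trans (≡.cong (λ c → table c k) codes≡) (≡.sym (act≡table i′ k))))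

        realizer : (∃ λ i → codeOf i ≡ j) → Σ Aut λ α → Realizes (fun α) (table j)
        realizer (i , codeOf-i≡j) = α i , λ k →
          trans (act-realizes (α i) k) (≡⇒≈s (≡.trans (act≡table i k) (≡.cong (λ c → table c k) codeOf-i≡j)))

    module Degenerate (t≉tx : ¬ (t ≈ t ∙ x)) (ty∈S₂ : t ∙ y ≈ t ⊎ t ∙ y ≈ t ∙ x) where
      open import Data.Fin.Properties using (_≟_; all?; pigeonhole; <-irrefl)
      open import Relation.Nullary.Decidable using (from-yes; ¬?; _→-dec_)

      embed : Fin 2 → Fin 3
      embed 0F = 0F
      embed 1F = 1F

      which : t ∙ y ≈ t ⊎ t ∙ y ≈ t ∙ x → Fin 2
      which (inj₁ _) = 0F
      which (inj₂ _) = 1F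

      ≈-which : ∀ ty∈ → t ∙ y ≈ s (embed (which ty∈))
      ≈-which (inj₁ ty≈t)  = ty≈t
      ≈-which (inj₂ ty≈tx) = ty≈tx

      collapse : Fin 3 → Fin 2
      collapse 0F = 0F
      collapse 1F = 1F
      collapse 2F = which ty∈S₂

      s-collapse : ∀ i → s i ≈ s (embed (collapse i))
      s-collapse 0F = refl
      s-collapse 1F = refl
      s-collapse 2F = ≈-which ty∈S₂

      act₂ : Aut → Fin 2 → Fin 2
      act₂ α u = collapse (act α (embed u))

      act₂-realizes : ∀ (α : Aut) u → fun α (s (embed u)) ≈ s (embed (act₂ α u))
      act₂-realizes α u = trans (act-realizes α (embed u)) (s-collapse (act α (embed u)))

      act₂-injective : ∀ (α : Aut) → act₂ α 0F ≢ act₂ α 1F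
      act₂-injective α α0≡α1 = t≉tx (IsGroupIsomorphism.injective (isAut α)
        (trans (act₂-realizes α 0F) (trans (≡⇒≈s (≡.cong embed α0≡α1)) (sym (act₂-realizes α 1F)))))

      ≈ᴬ-if-same-image-of-t : ∀ (α β : Aut) → act₂ α 0F ≡ act₂ β 0F → _≈A_ G t x y α β
      ≈ᴬ-if-same-image-of-t α β α0≡β0 = ≈ᴬ-on-S α β agree
        where
        the-other : ∀ (a b b′ : Fin 2) → a ≢ b → a ≢ b′ → b ≡ b′
        the-other = from-yes (all? {n = 2} λ a → all? λ b → all? λ b′ → ¬? (a ≟ b) →-dec ¬? (a ≟ b′) →-dec b ≟ b′)

        act₂≡ : ∀ u → act₂ α u ≡ act₂ β u
        act₂≡ 0F = α0≡β0
        act₂≡ 1F = the-other (act₂ β 0F) (act₂ α 1F) (act₂ β 1F)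
                     (λ β0≡α1 → act₂-injective α (≡.trans α0≡β0 β0≡α1)) (act₂-injective β)

        agree₂ : ∀ u → fun α (s (embed u)) ≈ fun β (s (embed u))
        agree₂ u = trans (act₂-realizes α u) (trans (≡⇒≈s (≡.cong embed (act₂≡ u))) (sym (act₂-realizes β u)))

        agree : ∀ i → fun α (s i) ≈ fun β (s i)
        agree i = trans (IsGroupHomomorphism.⟦⟧-cong (isHom α) (s-collapse i))
                        (trans (agree₂ (collapse i)) (sym (IsGroupHomomorphism.⟦⟧-cong (isHom β) (s-collapse i))))

      -- the image of t determines the automorphism, so two of six distinct ones collide
      ¬AutS≅S₃ : ¬ AutS≅S₃ G t x y
      ¬AutS≅S₃ iso with pigeonhole (ℕ.s≤s (ℕ.s≤s (ℕ.s≤s ℕ.z≤n))) (λ j → act₂ (sixAutomorphisms iso j) 0F)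
      ... | i , j , i<j , same = <-irrefl (sixAutomorphisms-distinct iso i j
        (≈ᴬ-if-same-image-of-t (sixAutomorphisms iso i) (sixAutomorphisms iso j) same)) i<j

module Presented {c ℓ} (n m l : ℕ) (G : Group c ℓ) (t x y : Group.Carrier G)
                 (presentation : IsPresentation G n m l t x y)
                 (2≤h : 2 ℕ.≤ n ℕ./ 2) (1≤m : 1 ℕ.≤ m) (l<2h : l ℕ.< 2 ℕ.* (n ℕ./ 2))
                 (l+m≡2k : l ℕ.+ m ≡ 2 ℕ.* ((l ℕ.+ m) ℕ./ 2)) where
  open import Data.Fin using (Fin)
  open import Data.Fin.Patterns using (0F; 1F; 2F)
  open import Relation.Nullary using (¬_; yes; no)
  open import Relation.Nullary.Decidable using (decidable-stable; ¬¬-excluded-middle; _×-dec_; _⊎-dec_)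
  open import Data.Integer using (+_; -_; 0ℤ)
  import Data.Nat.Properties as ℕ
  import Algebra.Morphism.Construct.Composition as Composition
  import Algebra.Morphism.Construct.Identity as Identity
  open Group G
  open GroupProperties G
    using (∙-cancelˡ; ⁻¹-involutive; ⁻¹-anti-homo-∙; ε⁻¹≈ε; \\-leftDividesˡ; //-rightDividesʳ)
  open Powers G
  open IsPresentation presentation
  open SetoidReasoning setoid
  open S₃ using (table)
  open AutomorphismsOfGenerators G t x y
  open Generated (λ {F} {F′} → unique G F F′)
  open AutS
  open GroupMorphisms rawGroup rawGroup using (IsGroupHomomorphism)
  module M = Model n m l c ℓ
  open M using (h; k; model; T; X; Y; model-relations; rotations-≈; Rels[Y,X]⇒InLattice; Rels[X⁻¹,X⁻¹Y]⇒InLattice)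
  open LatticeArithmetic h k m l 2≤h 1≤m l<2h l+m≡2k
  private
    module Mod = Group model

  canonical : Σ (Carrier → Mod.Carrier) λ π →
                GroupMorphisms.IsGroupHomomorphism rawGroup Mod.rawGroup π
                × π t Mod.≈ T × π x Mod.≈ X × π y Mod.≈ Y
  canonical = extend model T X Y model-relations

  π : Carrier → Mod.Carrier
  π = proj₁ canonical

  π-hom : GroupMorphisms.IsGroupHomomorphism rawGroup Mod.rawGroup π
  π-hom = proj₁ (proj₂ canonical)

  π-t : π t Mod.≈ T
  π-t = proj₁ (proj₂ (proj₂ canonical))

  π-x : π x Mod.≈ X
  π-x = proj₁ (proj₂ (proj₂ (proj₂ canonical)))

  π-y : π y Mod.≈ Y
  π-y = proj₂ (proj₂ (proj₂ (proj₂ canonical)))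

  private
    module π = GroupMorphisms.IsGroupHomomorphism π-hom

  π-≈ε : ∀ {g} → g ≈ ε → π g Mod.≈ Mod.ε
  π-≈ε g≈ε = Mod.trans (π.⟦⟧-cong g≈ε) π.ε-homo

  x≉ε : ¬ (x ≈ ε)
  x≉ε x≈ε = ¬InLattice[1,0] (rotations-≈ (Mod.trans (Mod.sym π-x) (π-≈ε x≈ε)))

  t≉tx : ¬ (t ≈ t ∙ x)
  t≉tx t≈tx = x≉ε (sym (∙-cancelˡ t ε x (trans (identityʳ t) t≈tx)))

  ty∉S₂ : l ≡ h → ¬ (t ∙ y ≈ t ⊎ t ∙ y ≈ t ∙ x)
  ty∉S₂ l≡h (inj₁ ty≈t) = ℕ.<⇒≢ 2≤h (≡.sym h≡1)
    where
    y≈ε : y ≈ ε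
    y≈ε = ∙-cancelˡ t y ε (trans ty≈t (sym (identityʳ t)))
    h+1≡2h : h ℕ.+ 1 ≡ 2 ℕ.* h
    h+1≡2h = ≡.subst (λ j → j ℕ.+ 1 ≡ 2 ℕ.* h) l≡h
               (proj₂ (InLattice[0,1]⇒ (rotations-≈ (Mod.trans (Mod.sym π-y) (π-≈ε y≈ε)))))
    h≡1 : h ≡ 1
    h≡1 = ≡.sym (≡.trans (ℕ.+-cancelˡ-≡ h 1 (h ℕ.+ 0) h+1≡2h) (ℕ.+-identityʳ h))
  ty∉S₂ l≡h (inj₂ ty≈tx) = ℕ.<⇒≢ 2≤h (≡.trans (≡.sym l≡1) l≡h)
    where
    x≈y : x ≈ y
    x≈y = sym (∙-cancelˡ t y x ty≈tx)
    l≡1 : l ≡ 1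
    l≡1 = proj₂ (InLattice[1,-1]⇒ (rotations-≈ (Mod.trans (Mod.sym π-x) (Mod.trans (π.⟦⟧-cong x≈y) π-y))))

  S : Fin 3 → Mod.Carrier
  S 0F = T
  S 1F = T Mod.∙ X
  S 2F = T Mod.∙ Y

  π-s : ∀ i → π (s i) Mod.≈ S i
  π-s 0F = π-t
  π-s 1F = Mod.trans (π.homo t x) (Mod.∙-cong π-t π-x)
  π-s 2F = Mod.trans (π.homo t y) (Mod.∙-cong π-t π-y)

  model-relations-of : ∀ (α : Aut) σ → Realizes (fun α) σ →
    Rels model n m l (S (σ 0F)) (S (σ 0F) Mod.⁻¹ Mod.∙ S (σ 1F)) (S (σ 0F) Mod.⁻¹ Mod.∙ S (σ 2F))
  model-relations-of α σ α↦σ =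
    Rels-cong {H = model} {n} {m} {l} (πα-s 0F) (translated x (πα-s 1F)) (translated y (πα-s 2F))
      (Rels-homo {G = G} {H = model} πα-hom {n} {m} {l} relations)
    where
    πα-hom : GroupMorphisms.IsGroupHomomorphism rawGroup Mod.rawGroup (λ g → π (fun α g))
    πα-hom = Composition.isGroupHomomorphism Mod.trans (isHom α) π-hom

    πα-s : ∀ i → π (fun α (s i)) Mod.≈ S (σ i)
    πα-s i = Mod.trans (π.⟦⟧-cong (α↦σ i)) (π-s (σ i))

    translated : ∀ g {u} → π (fun α (t ∙ g)) Mod.≈ u → π (fun α g) Mod.≈ S (σ 0F) Mod.⁻¹ Mod.∙ u
    translated g πα[tg]≈u = Mod.trans (⟦⟧-translate {G = G} {H = model} πα-hom t g)
                                      (Mod.∙-cong (Mod.⁻¹-cong (πα-s 0F)) πα[tg]≈u)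

  realized⇒conditions : (∀ j → Σ Aut λ α → Realizes (fun α) (table j)) → l ≡ h × (l ≡ m ⊎ l ≡ 3 ℕ.* m)
  realized⇒conditions realize =
    InLattice-conditions⇒ (proj₁ swapped) (proj₂ swapped)
      (Rels[X⁻¹,X⁻¹Y]⇒InLattice {T Mod.∙ X} {X Mod.⁻¹} {X Mod.⁻¹ Mod.∙ Y} Mod.refl Mod.refl flip-relations)
    where
    swap-relations : Rels model n m l T Y X
    swap-relations = model-relations-of (proj₁ (realize 1F)) (table 1F) (proj₂ (realize 1F))
    flip-relations : Rels model n m l (T Mod.∙ X) (X Mod.⁻¹) (X Mod.⁻¹ Mod.∙ Y)
    flip-relations = model-relations-of (proj₁ (realize 2F)) (table 2F) (proj₂ (realize 2F))
    swapped : M.InLattice (0ℤ , + h) × M.InLattice (+ m , - + k)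
    swapped = Rels[Y,X]⇒InLattice {T} {Y} {X} Mod.refl Mod.refl swap-relations

  t²≈ε : t ∙ t ≈ ε
  t²≈ε = proj₁ relations

  xʰ≈ε : x ^ h ≈ ε
  xʰ≈ε = proj₁ (proj₂ relations)

  yᵐ≈xᵏ : y ^ m ≈ x ^ k
  yᵐ≈xᵏ = proj₁ (proj₂ (proj₂ relations))

  txt≈x⁻¹ : (t ∙ x) ∙ t ≈ x ⁻¹
  txt≈x⁻¹ = proj₁ (proj₂ (proj₂ (proj₂ relations)))

  tyt≈y⁻¹ : (t ∙ y) ∙ t ≈ y ⁻¹
  tyt≈y⁻¹ = proj₁ (proj₂ (proj₂ (proj₂ (proj₂ relations))))

  xy≈yx : x ∙ y ≈ y ∙ x
  xy≈yx = proj₂ (proj₂ (proj₂ (proj₂ (proj₂ relations))))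

  module _ (l≡h : l ≡ h) where
    private
      open import Data.Nat.Tactic.RingSolver using (solve-∀)

      h+m≡2k : h ℕ.+ m ≡ 2 ℕ.* k
      h+m≡2k = ≡.trans (≡.cong (ℕ._+ m) (≡.sym l≡h)) l+m≡2k

    xᵐ≈xᵏxᵏ : x ^ m ≈ x ^ k ∙ x ^ k
    xᵐ≈xᵏxᵏ = begin
      x ^ m              ≈⟨ ^-periodic h m xʰ≈ε ⟨
      x ^ (h ℕ.+ m)      ≈⟨ ^-congʳ (≡.trans h+m≡2k (≡.cong (k ℕ.+_) (ℕ.+-identityʳ k))) ⟩
      x ^ (k ℕ.+ k)      ≈⟨ ^-+ x k k ⟩
      x ^ k ∙ x ^ k      ∎

    swap-powers : l ≡ m ⊎ l ≡ 3 ℕ.* m → y ^ h ≈ ε × x ^ m ≈ y ^ k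
    swap-powers (inj₁ l≡m) = yʰ≈ε , xᵐ≈yᵏ
      where
      h≡m : h ≡ m
      h≡m = ≡.trans (≡.sym l≡h) l≡m
      k≡m : k ≡ m
      k≡m = ℕ.*-cancelˡ-≡ k m 2 (≡.trans (≡.sym h+m≡2k) (≡.trans (≡.cong (ℕ._+ m) h≡m) (double m)))
        where
        double : ∀ m → m ℕ.+ m ≡ 2 ℕ.* m
        double = solve-∀
      yʰ≈ε : y ^ h ≈ ε
      yʰ≈ε = begin
        y ^ h   ≈⟨ ^-congʳ h≡m ⟩
        y ^ m   ≈⟨ yᵐ≈xᵏ ⟩
        x ^ k   ≈⟨ ^-congʳ (≡.trans k≡m (≡.sym h≡m)) ⟩
        x ^ h   ≈⟨ xʰ≈ε ⟩
        ε       ∎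
      xᵐ≈yᵏ : x ^ m ≈ y ^ k
      xᵐ≈yᵏ = begin
        x ^ m   ≈⟨ ^-congʳ (≡.sym k≡m) ⟩
        x ^ k   ≈⟨ yᵐ≈xᵏ ⟨
        y ^ m   ≈⟨ ^-congʳ (≡.sym k≡m) ⟩
        y ^ k   ∎
    swap-powers (inj₂ l≡3m) = yʰ≈ε , xᵐ≈yᵏ
      where
      h≡3m : h ≡ 3 ℕ.* m
      h≡3m = ≡.trans (≡.sym l≡h) l≡3m
      k≡2m : k ≡ 2 ℕ.* m
      k≡2m = ℕ.*-cancelˡ-≡ k (2 ℕ.* m) 2 (≡.trans (≡.sym h+m≡2k) (≡.trans (≡.cong (ℕ._+ m) h≡3m) (quadruple m)))
        where
        quadruple : ∀ m → 3 ℕ.* m ℕ.+ m ≡ 2 ℕ.* (2 ℕ.* m)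
        quadruple = solve-∀
      3k≡2h : 3 ℕ.* k ≡ 2 ℕ.* h
      3k≡2h = ≡.trans (≡.cong (3 ℕ.*_) k≡2m) (≡.trans (sextuple m) (≡.cong (2 ℕ.*_) (≡.sym h≡3m)))
        where
        sextuple : ∀ m → 3 ℕ.* (2 ℕ.* m) ≡ 2 ℕ.* (3 ℕ.* m)
        sextuple = solve-∀
      yʰ≈ε : y ^ h ≈ ε
      yʰ≈ε = begin
        y ^ h              ≈⟨ ^-congʳ h≡3m ⟩
        y ^ (3 ℕ.* m)      ≈⟨ ^-* y 3 m ⟩
        (y ^ m) ^ 3        ≈⟨ ^-congˡ 3 yᵐ≈xᵏ ⟩
        (x ^ k) ^ 3        ≈⟨ ^-* x 3 k ⟨
        x ^ (3 ℕ.* k)      ≈⟨ ^-congʳ 3k≡2h ⟩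
        x ^ (2 ℕ.* h)      ≈⟨ ^-multiple≈ε h 2 xʰ≈ε ⟩
        ε                  ∎
      xᵐ≈yᵏ : x ^ m ≈ y ^ k
      xᵐ≈yᵏ = begin
        x ^ m              ≈⟨ ^-periodic h m xʰ≈ε ⟨
        x ^ (h ℕ.+ m)      ≈⟨ ^-congʳ h+m≡2k ⟩
        x ^ (2 ℕ.* k)      ≈⟨ ^-* x 2 k ⟩
        (x ^ k) ^ 2        ≈⟨ ^-congˡ 2 yᵐ≈xᵏ ⟨
        (y ^ m) ^ 2        ≈⟨ ^-* y 2 m ⟨
        y ^ (2 ℕ.* m)      ≈⟨ ^-congʳ (≡.sym k≡2m) ⟩
        y ^ k              ∎

    flip-relations : Rels G n m l (t ∙ x) (x ⁻¹) (x ⁻¹ ∙ y)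
    flip-relations = [tx]²≈ε , [x⁻¹]ʰ≈ε , [x⁻¹y]ᵐ≈[x⁻¹]ᵏ , conj-x⁻¹ , conj-x⁻¹y , x⁻¹-comm-x⁻¹y
      where
      x⁻¹y≈yx⁻¹ : x ⁻¹ ∙ y ≈ y ∙ x ⁻¹
      x⁻¹y≈yx⁻¹ = ⁻¹-comm xy≈yx

      [tx]²≈ε : (t ∙ x) ∙ (t ∙ x) ≈ ε
      [tx]²≈ε = begin
        (t ∙ x) ∙ (t ∙ x)   ≈⟨ assoc (t ∙ x) t x ⟨
        ((t ∙ x) ∙ t) ∙ x   ≈⟨ ∙-congʳ txt≈x⁻¹ ⟩
        x ⁻¹ ∙ x            ≈⟨ inverseˡ x ⟩
        ε                   ∎

      [x⁻¹]ʰ≈ε : (x ⁻¹) ^ h ≈ ε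
      [x⁻¹]ʰ≈ε = trans (⁻¹-^ x h) (trans (⁻¹-cong xʰ≈ε) ε⁻¹≈ε)

      [x⁻¹y]ᵐ≈[x⁻¹]ᵏ : (x ⁻¹ ∙ y) ^ m ≈ (x ⁻¹) ^ k
      [x⁻¹y]ᵐ≈[x⁻¹]ᵏ = begin
        (x ⁻¹ ∙ y) ^ m                          ≈⟨ ^-distrib-∙ m x⁻¹y≈yx⁻¹ ⟩
        (x ⁻¹) ^ m ∙ y ^ m                      ≈⟨ ∙-cong (⁻¹-^ x m) yᵐ≈xᵏ ⟩
        (x ^ m) ⁻¹ ∙ x ^ k                      ≈⟨ ∙-congʳ (⁻¹-cong xᵐ≈xᵏxᵏ) ⟩
        (x ^ k ∙ x ^ k) ⁻¹ ∙ x ^ k              ≈⟨ ∙-congʳ (⁻¹-anti-homo-∙ (x ^ k) (x ^ k)) ⟩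
        ((x ^ k) ⁻¹ ∙ (x ^ k) ⁻¹) ∙ x ^ k       ≈⟨ assoc _ _ _ ⟩
        (x ^ k) ⁻¹ ∙ ((x ^ k) ⁻¹ ∙ x ^ k)       ≈⟨ ∙-congˡ (inverseˡ (x ^ k)) ⟩
        (x ^ k) ⁻¹ ∙ ε                          ≈⟨ identityʳ _ ⟩
        (x ^ k) ⁻¹                              ≈⟨ ⁻¹-^ x k ⟨
        (x ⁻¹) ^ k                              ∎

      conj-x⁻¹ : ((t ∙ x) ∙ x ⁻¹) ∙ (t ∙ x) ≈ (x ⁻¹) ⁻¹
      conj-x⁻¹ = begin
        ((t ∙ x) ∙ x ⁻¹) ∙ (t ∙ x)   ≈⟨ ∙-congʳ (//-rightDividesʳ x t) ⟩
        t ∙ (t ∙ x)                  ≈⟨ assoc t t x ⟨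
        (t ∙ t) ∙ x                  ≈⟨ ∙-congʳ t²≈ε ⟩
        ε ∙ x                        ≈⟨ identityˡ x ⟩
        x                            ≈⟨ ⁻¹-involutive x ⟨
        (x ⁻¹) ⁻¹                    ∎

      conj-x⁻¹y : ((t ∙ x) ∙ (x ⁻¹ ∙ y)) ∙ (t ∙ x) ≈ (x ⁻¹ ∙ y) ⁻¹
      conj-x⁻¹y = begin
        ((t ∙ x) ∙ (x ⁻¹ ∙ y)) ∙ (t ∙ x)   ≈⟨ ∙-congʳ (assoc t x (x ⁻¹ ∙ y)) ⟩
        (t ∙ (x ∙ (x ⁻¹ ∙ y))) ∙ (t ∙ x)   ≈⟨ ∙-congʳ (∙-congˡ (\\-leftDividesˡ x y)) ⟩
        (t ∙ y) ∙ (t ∙ x)                  ≈⟨ assoc (t ∙ y) t x ⟨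
        ((t ∙ y) ∙ t) ∙ x                  ≈⟨ ∙-congʳ tyt≈y⁻¹ ⟩
        y ⁻¹ ∙ x                           ≈⟨ ∙-congˡ (⁻¹-involutive x) ⟨
        y ⁻¹ ∙ (x ⁻¹) ⁻¹                   ≈⟨ ⁻¹-anti-homo-∙ (x ⁻¹) y ⟨
        (x ⁻¹ ∙ y) ⁻¹                      ∎

      x⁻¹-comm-x⁻¹y : x ⁻¹ ∙ (x ⁻¹ ∙ y) ≈ (x ⁻¹ ∙ y) ∙ x ⁻¹
      x⁻¹-comm-x⁻¹y = trans (∙-congˡ x⁻¹y≈yx⁻¹) (sym (assoc (x ⁻¹) y (x ⁻¹)))

    swap-relations : l ≡ m ⊎ l ≡ 3 ℕ.* m → Rels G n m l t y x
    swap-relations cases =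
      t²≈ε , proj₁ (swap-powers cases) , proj₂ (swap-powers cases) , tyt≈y⁻¹ , txt≈x⁻¹ , sym xy≈yx

    swap : l ≡ m ⊎ l ≡ 3 ℕ.* m → Σ Aut λ α → Realizes (fun α) (table 1F)
    swap cases = from-extension (extend G t y x (swap-relations cases))
      where
      from-extension : (Σ (Carrier → Carrier) λ F → IsGroupHomomorphism F × F t ≈ t × F x ≈ y × F y ≈ x) →
                       Σ Aut λ α → Realizes (fun α) (table 1F)
      from-extension (F , F-hom , Ft≈t , Fx≈y , Fy≈x) = involution {σ = table 1F} F-hom F²≈id F↦ , F↦
        where
        module F = IsGroupHomomorphism F-hom
        F↦ : Realizes F (table 1F)
        F↦ 0F = Ft≈t
        F↦ 1F = trans (F.homo t x) (∙-cong Ft≈t Fx≈y)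
        F↦ 2F = trans (F.homo t y) (∙-cong Ft≈t Fy≈x)
        F²≈id : ∀ g → F (F g) ≈ g
        F²≈id = unique G _ _ (Composition.isGroupHomomorphism trans F-hom F-hom)
                  (Identity.isGroupHomomorphism rawGroup refl)
                  (trans (F.⟦⟧-cong Ft≈t) Ft≈t) (trans (F.⟦⟧-cong Fx≈y) Fy≈x) (trans (F.⟦⟧-cong Fy≈x) Fx≈y)

    flip : Σ Aut λ α → Realizes (fun α) (table 2F)
    flip = from-extension (extend G (t ∙ x) (x ⁻¹) (x ⁻¹ ∙ y) flip-relations)
      where
      from-extension : (Σ (Carrier → Carrier) λ F → IsGroupHomomorphism F
                          × F t ≈ t ∙ x × F x ≈ x ⁻¹ × F y ≈ x ⁻¹ ∙ y) →
                       Σ Aut λ α → Realizes (fun α) (table 2F)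
      from-extension (F , F-hom , Ft≈tx , Fx≈x⁻¹ , Fy≈x⁻¹y) = involution {σ = table 2F} F-hom F²≈id F↦ , F↦
        where
        module F = IsGroupHomomorphism F-hom
        F↦ : Realizes F (table 2F)
        F↦ 0F = Ft≈tx
        F↦ 1F = trans (F.homo t x) (trans (∙-cong Ft≈tx Fx≈x⁻¹) (//-rightDividesʳ x t))
        F↦ 2F = trans (F.homo t y) (trans (∙-cong Ft≈tx Fy≈x⁻¹y)
                  (trans (assoc t x (x ⁻¹ ∙ y)) (∙-congˡ (\\-leftDividesˡ x y))))
        Fx⁻¹≈x : F (x ⁻¹) ≈ x
        Fx⁻¹≈x = trans (F.⁻¹-homo x) (trans (⁻¹-cong Fx≈x⁻¹) (⁻¹-involutive x))
        F²≈id : ∀ g → F (F g) ≈ g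
        F²≈id = unique G _ _ (Composition.isGroupHomomorphism trans F-hom F-hom)
                  (Identity.isGroupHomomorphism rawGroup refl)
                  (trans (F.⟦⟧-cong Ft≈tx) (F↦ 1F))
                  (trans (F.⟦⟧-cong Fx≈x⁻¹) Fx⁻¹≈x)
                  (trans (F.⟦⟧-cong Fy≈x⁻¹y) (trans (F.homo (x ⁻¹) y)
                    (trans (∙-cong Fx⁻¹≈x Fy≈x⁻¹y) (\\-leftDividesˡ x y))))

  conditions⇒AutS≅S₃ : l ≡ h → l ≡ m ⊎ l ≡ 3 ℕ.* m → AutS≅S₃ G t x y
  conditions⇒AutS≅S₃ l≡h cases =
    Distinct.AutS≅S₃-if-realized (s-injective t≉tx (ty∉S₂ l≡h))
      (realized-from-transpositions (swap l≡h cases) (flip l≡h))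

  -- Whether ty ∈ {t, tx} is not decidable in G; since the conclusion is
  -- decidable, it suffices to refute its negation.
  AutS≅S₃⇒conditions : AutS≅S₃ G t x y → l ≡ h × (l ≡ m ⊎ l ≡ 3 ℕ.* m)
  AutS≅S₃⇒conditions iso =
    decidable-stable (l ℕ.≟ h ×-dec (l ℕ.≟ m ⊎-dec l ℕ.≟ 3 ℕ.* m)) λ ¬conditions →
      ¬¬-excluded-middle λ where
        (yes ty∈S₂) → Degenerate.¬AutS≅S₃ t≉tx ty∈S₂ iso
        (no  ty∉S₂) → ¬conditions (realized⇒conditions
                        (Distinct.realized-if-AutS≅S₃ (s-injective t≉tx ty∉S₂) iso))

open import Data.Nat using (_≤_; _∸_; _+_; _*_)
open import Data.Nat.Divisibility using (_∣_)
open import Function.Bundles using (_⇔_; mk⇔)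

corollary4p5 : ∀ {c ℓ′} (n m l : ℕ) → 1 ≤ m → 4 ≤ n → 2 ∣ n → l ≤ n ∸ 1 → 2 ∣ (l + m) →
    (G : Group c ℓ′) (t x y : Group.Carrier G) → IsPresentation G n m l t x y →
    AutS≅S₃ G t x y ⇔ ((n ≡ 2 * l) × ((l ≡ m) ⊎ (l ≡ 3 * m)))
corollary4p5 n m l 1≤m 4≤n 2∣n l≤n∸1 2∣l+m G t x y presentation = mk⇔
    (λ iso → let l≡h , cases = AutS≅S₃⇒conditions iso in l≡h⇒n≡2l l≡h , cases)
    (λ (n≡2l , cases) → conditions⇒AutS≅S₃ (n≡2l⇒l≡h n≡2l) cases)
  where
  import Data.Nat.Properties as ℕ
  open import Data.Nat.DivMod using (m*[n/m]≡n; _/_)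

  h : ℕ
  h = n / 2

  2h≡n : 2 * h ≡ n
  2h≡n = m*[n/m]≡n 2∣n

  l≡h⇒n≡2l : l ≡ h → n ≡ 2 * l
  l≡h⇒n≡2l l≡h = ≡.trans (≡.sym 2h≡n) (≡.cong (2 *_) (≡.sym l≡h))

  n≡2l⇒l≡h : n ≡ 2 * l → l ≡ h
  n≡2l⇒l≡h n≡2l = ℕ.*-cancelˡ-≡ l h 2 (≡.trans (≡.sym n≡2l) (≡.sym 2h≡n))

  2≤h : 2 ≤ h
  2≤h = ℕ.*-cancelˡ-≤ 2 (≡.subst (4 ≤_) (≡.sym 2h≡n) 4≤n)

  l<2h : l ℕ.< 2 * h
  l<2h = ≡.subst (l ℕ.<_) (≡.sym 2h≡n) (≤∸1⇒< n (ℕ.≤-trans (ℕ.s≤s ℕ.z≤n) 4≤n) l≤n∸1)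
    where
    ≤∸1⇒< : ∀ {a} b → 1 ≤ b → a ≤ b ∸ 1 → a ℕ.< b
    ≤∸1⇒< (suc b) _ a≤b = ℕ.s≤s a≤b

  open Presented n m l G t x y presentation 2≤h 1≤m l<2h (≡.sym (m*[n/m]≡n 2∣l+m))
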